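{- Let $p>2$ be a prime. The finite Browkin continued fraction $\left[\frac1p,\frac{1-p}{p},\frac{1+p}{p}\right]$ is nice. Consequently, there are infinitely many integers $b$ such that $b$ has a square root $\sqrt b\in\mathbb{Q}_p$ whose Browkin continued fraction expansion is periodic with period of length $6$.
   Context: Let $\mathcal{Y}=\mathbb{Z}[1/p]\cap(-p/2,p/2)$; for $\gamma\in\mathbb{Q}_p$, $s(\gamma)$ is the unique element of $\mathcal{Y}$ with $|\gamma-s(\gamma)|_p<1$, and the Browkin continued fraction of $\gamma$ is obtained by $\gamma_0=\gamma$, $a_n=s(\gamma_n)$, $\gamma_{n+1}=1/(\gamma_n-a_n)$. A finite Browkin continued fraction $[a_0,\dots,a_{t-1}]$ is a sequence in $\mathcal{Y}$ with $|a_i|_p>1$ for $i\ge1$; its convergent sequences are $A_{ -1}=1$, $A_0=a_0$, $B_{ -1}=0$, $B_0=1$, $A_n=a_nA_{n-1}+A_{n-2}$, $B_n=a_nB_{n-1}+B_{n-2}$. For nonzero $x\in\mathbb{Z}[1/p]$, $\tilde x=x\,p^{ -v_p(x)}$. The finite BCF is nice if: (a) $|a_0|_p>1$ and $|a_0|_\infty<\frac p4$; (b) $\left|\frac{A_{t-1}}{A_{t-2}}\right|_\infty>\frac4p$; (c) there exists an integer $q$ with $\tilde B_{t-1}\mid q\mid\tilde B_{t-1}^2$ whose class modulo $\tilde A_{t-1}^2$ belongs to the multiplicative subgroup generated by the class of $p$. -}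

module Defs where

open import Data.Nat as ℕ using (ℕ; zero; suc)
open import Data.Nat.Divisibility as ℕD using ()
open import Data.Integer as ℤ using (ℤ; +_)
open import Data.Integer.Divisibility as ℤD using ()
open import Data.Rational as ℚ using (ℚ; ↥_; ↧ₙ_; _/_; 0ℚ; 1ℚ)
open import Data.List using (List; []; _∷_; foldl)
open import Data.List.Relation.Unary.All using (All)
open import Data.Product using (Σ; ∃; _×_; _,_)
open import Data.Sum using (_⊎_)
open import Relation.Nullary using (¬_)
open import Relation.Binary.PropositionalEquality using (_≡_; _≢_)

-- the rational number n / d (d is always a prime p > 2 where used;
-- the value for d = 0 is an irrelevant default)
_/ℕ_ : ℤ → ℕ → ℚ
n /ℕ zero    = 0ℚ
n /ℕ (suc d) = n / suc d

ℤ→ℚ : ℤ → ℚ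
ℤ→ℚ n = n / 1

ℕ→ℚ : ℕ → ℚ
ℕ→ℚ n = + n / 1

InZ1/p : ℕ → ℚ → Set
InZ1/p p x = ∃ λ m → ↧ₙ x ≡ p ℕ.^ m

In𝒴 : ℕ → ℚ → Set
In𝒴 p x = InZ1/p p x × (ℚ.- (ℕ→ℚ p ℚ.* ℚ.½)) ℚ.< x × x ℚ.< ℕ→ℚ p ℚ.* ℚ.½

-- |x|_p > 1  (i.e. v_p(x) < 0, i.e. p divides the reduced denominator)
AbsP>1 : ℕ → ℚ → Set
AbsP>1 p x = p ℕD.∣ (↧ₙ x)

-- x̃ = x p^{-v_p(x)} for nonzero x ∈ Z[1/p]:  IsTilde p x t  means t = x̃,
-- i.e. t is an integer not divisible by p and x = t · p^j for some j ∈ ℤ.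
IsTilde : ℕ → ℚ → ℤ → Set
IsTilde p x t =
  ¬ ((+ p) ℤD.∣ t) ×
  ∃ λ (k : ℕ) → (x ℚ.* ℕ→ℚ (p ℕ.^ k) ≡ ℤ→ℚ t) ⊎ (x ≡ ℤ→ℚ t ℚ.* ℕ→ℚ (p ℕ.^ k))

record Conv : Set where
  constructor conv
  field
    Acur Aprev Bcur Bprev : ℚ

convStep : Conv → ℚ → Conv
convStep (conv A₁ A₂ B₁ B₂) a = conv (a ℚ.* A₁ ℚ.+ A₂) A₁ (a ℚ.* B₁ ℚ.+ B₂) B₁

-- starting from (A_{-1}, A_{-2}, B_{-1}, B_{-2}) = (1, 0, 0, 1) (so that
-- A_0 = a_0, B_0 = 1), returns (A_{t-1}, A_{t-2}, B_{t-1}, B_{t-2}).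
convergents : List ℚ → Conv
convergents = foldl convStep (conv 1ℚ 0ℚ 0ℚ 1ℚ)

IsFiniteBCF : ℕ → List ℚ → Set
IsFiniteBCF p []       = Data.Empty.⊥ where import Data.Empty
IsFiniteBCF p (a₀ ∷ as) = In𝒴 p a₀ × All (λ a → In𝒴 p a × AbsP>1 p a) as

Nice : ℕ → List ℚ → Set
Nice p []        = Data.Empty.⊥ where import Data.Empty
Nice p (a₀ ∷ as) =
  IsFiniteBCF p (a₀ ∷ as) ×
  (AbsP>1 p a₀ × ℚ.∣ a₀ ∣ ℚ.* ℕ→ℚ 4 ℚ.< ℕ→ℚ p) ×
  -- (b)  |A_{t-1} / A_{t-2}|_∞ > 4/p   (A_{t-2} ≠ 0, cleared denominators)
  (Conv.Aprev C ≢ 0ℚ × ℕ→ℚ 4 ℚ.* ℚ.∣ Conv.Aprev C ∣ ℚ.< ℕ→ℚ p ℚ.* ℚ.∣ Conv.Acur C ∣) ×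
  (∃ λ Ã → ∃ λ B̃ → IsTilde p (Conv.Acur C) Ã × IsTilde p (Conv.Bcur C) B̃ ×
     ∃ λ (q : ℤ) → B̃ ℤD.∣ q × q ℤD.∣ (B̃ ℤ.* B̃) ×
       ∃ λ (k : ℕ) → (Ã ℤ.* Ã) ℤD.∣ (q ℤ.- (+ (p ℕ.^ k))))
  where C = convergents (a₀ ∷ as)

-- The p-adic numbers ℚ_p.
-- An element is a pair (e , x) with x : ℕ → ℤ a p-adically Cauchy sequence
-- (p^k ∣ x (k+1) - x k); it represents p^{-e} · lim x.

record ℚₚ : Set where
  constructor _,ₚ_
  field
    ex  : ℕ
    seq : ℕ → ℤ

open ℚₚ public

IsQp : ℕ → ℚₚ → Set
IsQp p γ = ∀ k → (+ (p ℕ.^ k)) ℤD.∣ (seq γ (suc k) ℤ.- seq γ k)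

_≈[_]_ : ℚₚ → ℕ → ℚₚ → Set
(e ,ₚ x) ≈[ p ] (f ,ₚ y) =
  ∀ k → (+ (p ℕ.^ k)) ℤD.∣ ((+ (p ℕ.^ f)) ℤ.* x k ℤ.- (+ (p ℕ.^ e)) ℤ.* y k)

mulₚ : ℚₚ → ℚₚ → ℚₚ
mulₚ (e ,ₚ x) (f ,ₚ y) = (e ℕ.+ f) ,ₚ (λ k → x k ℤ.* y k)

subₚ : ℕ → ℚₚ → ℚₚ → ℚₚ
subₚ p (e ,ₚ x) (f ,ₚ y) =
  (e ℕ.+ f) ,ₚ (λ k → (+ (p ℕ.^ f)) ℤ.* x k ℤ.- (+ (p ℕ.^ e)) ℤ.* y k)

ιₚ : ℤ → ℚₚ
ιₚ n = 0 ,ₚ (λ _ → n)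

Represents : ℕ → ℚₚ → ℚ → Set
Represents p γ r = mulₚ (ιₚ (+ (↧ₙ r))) γ ≈[ p ] ιₚ (↥ r)

AbsP<1 : ℕ → ℚₚ → Set
AbsP<1 p (e ,ₚ x) = (+ (p ℕ.^ suc e)) ℤD.∣ x (suc e)

-- Browkin continued fraction expansion of γ ∈ ℚ_p:
-- a : ℕ → ℚ is the sequence of partial quotients of γ, i.e. there are
-- complete quotients Γ n ∈ ℚ_p with Γ 0 = γ, a n = s(Γ n) (a n ∈ 𝒴 and
-- |Γ n - a n|_p < 1) and Γ (n+1) = 1 / (Γ n - a n).
-- (α n is the element a n viewed in ℚ_p.)
IsBrowkinCF : ℕ → ℚₚ → (ℕ → ℚ) → Set
IsBrowkinCF p γ a =
  Σ (ℕ → ℚₚ) λ Γ → Σ (ℕ → ℚₚ) λ α →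
    (Γ 0 ≈[ p ] γ) ×
    (∀ n → IsQp p (Γ n)) ×
    (∀ n → IsQp p (α n) × Represents p (α n) (a n)) ×
    (∀ n → In𝒴 p (a n)) ×
    (∀ n → AbsP<1 p (subₚ p (Γ n) (α n))) ×
    (∀ n → mulₚ (Γ (suc n)) (subₚ p (Γ n) (α n)) ≈[ p ] ιₚ (+ 1))

HasPeriod : (ℕ → ℚ) → ℕ → Set
HasPeriod a T = ∃ λ N → ∀ n → N ℕ.≤ n → a (n ℕ.+ T) ≡ a n

PeriodLength : (ℕ → ℚ) → ℕ → Set
PeriodLength a T = HasPeriod a T × (∀ T′ → 0 ℕ.< T′ → T′ ℕ.< T → ¬ HasPeriod a T′)

{-# OPTIONS --safe #-}
module Submission where

-- Niceness is a direct computation: writing x = 1/p, the digits are x, x - 1 and x + 1, the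
-- last two convergents are A = x³ + x + 1, A′ = x² - x + 1 and B = x², so Ã = p³ + p² + 1,
-- B̃ = 1, and q = 1 = p⁰ witnesses (c).
--
-- For the periodic square roots, √b ∈ ℤ_p is obtained by Newton's iteration from an integer T
-- with T² ≡ b modulo a high power D of p, and its Browkin expansion is read off from complete
-- quotients Γₙ = (Pₙ + √b)/Qₙ: if aₙ = mₙ/p^fₙ, Pₙ₊₁ = aₙQₙ - Pₙ, QₙQₙ₊₁ = b - Pₙ₊₁² and
-- Pₙ₊₁ ≡ T modulo p^(vₚ(Qₙ)+1), then aₙ = s(Γₙ) and Γₙ₊₁ = 1/(Γₙ - aₙ). Such data cycling
-- with period six, polynomial in a parameter that makes |b| arbitrarily large, exist for
-- p ≥ 5 (b = -L(L + 1) with 2L + 1 = p^(n+2)) and for p = 3 (b = -(59049 Y + 488) with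
-- 121 Y + 1 = 3^(5t)).

open import Defs
open import Data.Nat using (ℕ; _<_)
open import Data.Nat.Primality using (Prime)
open import Data.Integer using (ℤ; +_; -_; _+_; ∣_∣)
open import Data.List using (_∷_; [])
open import Data.Product using (Σ; _×_)
open import Data.Nat using (_≤_)
open import Data.Rational using (ℚ)

open import Data.Nat as ℕ using (zero; suc; s≤s; z≤n)
import Data.Nat.Properties as ℕP
import Data.Nat.Divisibility as ℕD
open import Data.Nat.Coprimality using (Coprime)
import Data.Nat.Coprimality as Coprime
open import Data.Nat.Primality using (prime⇒irreducible)
import Data.Nat.Tactic.RingSolver as ℕ-Solver
open import Data.Integer as ℤ using (-[1+_]; _*_; _-_)
import Data.Integer.Properties as ℤP
import Data.Integer.Divisibility as ℤᵘ
open import Data.Integer.Divisibility.Signed as ℤD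
  using (_∣_; divides; ∣-refl; ∣-trans; ∣m∣n⇒∣m+n; ∣m∣n⇒∣m-n;
        ∣m+n∣m⇒∣n; ∣m⇒∣-m; ∣n⇒∣m*n; ∣m⇒∣m*n; ∣⇒∣ᵤ)
open import Data.Integer.Tactic.RingSolver using (solve-∀; solve)
open import Data.Rational as ℚ using (mkℚ; ↥_; ↧_; ↧ₙ_; _/_; toℚᵘ)
import Data.Rational.Properties as ℚP
open import Data.Rational.Unnormalised as ℚᵘ using (ℚᵘ; mkℚᵘ; *≡*; *<*)
import Data.Rational.Unnormalised.Properties as ℚᵘP
import Data.List.Relation.Unary.All as All
open import Data.Product using (_,_; proj₁; proj₂; ∃)
open import Data.Sum using (_⊎_; inj₁; inj₂)
open import Relation.Nullary.Decidable using (True; toWitness)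
open import Data.Empty using (⊥-elim)
open import Relation.Nullary using (¬_)
open import Relation.Binary.PropositionalEquality

∣0 : ∀ d → d ∣ + 0
∣0 d = divides (+ 0) (sym (ℤP.*-zeroˡ d))

∣-resp-≡ : ∀ {d x y} → x ≡ y → d ∣ y → d ∣ x
∣-resp-≡ refl d∣y = d∣y

∣-respˡ-≡ : ∀ {d d′ x} → d ≡ d′ → d ∣ x → d′ ∣ x
∣-respˡ-≡ refl d∣x = d∣x

≡⇒∣- : ∀ {d x y} → x ≡ y → d ∣ x - y
≡⇒∣- {d} {x} refl = ∣-resp-≡ (ℤP.+-inverseʳ x) (∣0 d)

*-pres-∣ : ∀ {a b x y} → a ∣ x → b ∣ y → a * b ∣ x * y
*-pres-∣ {a} {b} (divides k refl) (divides j refl) = divides (k * j) (regroup k a j b)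
  where
  regroup : ∀ k a j b → (k * a) * (j * b) ≡ (k * j) * (a * b)
  regroup = solve-∀

∣-via : ∀ {d x y z} → d ∣ x - y → d ∣ y - z → d ∣ x - z
∣-via {x = x} {y} {z} d∣x-y d∣y-z = ∣-resp-≡ (telescope x y z) (∣m∣n⇒∣m+n d∣x-y d∣y-z)
  where
  telescope : ∀ x y z → x - z ≡ (x - y) + (y - z)
  telescope = solve-∀

-- The Browkin recurrences for a quadratic irrational (P + √b)/Q with a partial quotient
-- a = m/d:  P′ = a Q - P  and  b - P′² = Q Q′, with the first cleared of denominators.
CFStep : (b d m Q Q′ P P′ : ℤ) → Set
CFStep b d m Q Q′ P P′ = (d * P′ ≡ m * Q - d * P) × (b - P′ * P′ ≡ Q * Q′)

module PAdic (p : ℕ) where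

  p^_ : ℕ → ℤ
  p^ k = + (p ℕ.^ k)

  p^-+ : ∀ a b → p^ (a ℕ.+ b) ≡ p^ a * p^ b
  p^-+ a b = trans (cong +_ (ℕP.^-distribˡ-+-* p a b)) (ℤP.pos-* (p ℕ.^ a) (p ℕ.^ b))

  p^-suc : ∀ a → p^ (suc a) ≡ + p * p^ a
  p^-suc a = ℤP.pos-* p (p ℕ.^ a)

  p^-1 : p^ 1 ≡ + p
  p^-1 = cong +_ (ℕP.*-identityʳ p)

  p^∣p^-+ : ∀ a b → p^ a ∣ p^ (a ℕ.+ b)
  p^∣p^-+ a b = divides (p^ b) (trans (p^-+ a b) (ℤP.*-comm (p^ a) (p^ b)))

  p^∣p^-suc : ∀ a → p^ a ∣ p^ (suc a)
  p^∣p^-suc a = divides (+ p) (p^-suc a)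

  p^-∣ᵤ : ∀ K {x} → p^ K ∣ x → (+ (p ℕ.^ K)) ℤᵘ.∣ x
  p^-∣ᵤ K = ∣⇒∣ᵤ

  p∣p^-suc : ∀ a → + p ∣ p^ (suc a)
  p∣p^-suc a = divides (p^ a) (trans (p^-suc a) (ℤP.*-comm (+ p) (p^ a)))

  -- Newton's iteration for √b, with h an approximation of 1/(2 c₀)
  module NewtonSqrt (b c₀ h D : ℤ) (D∣c₀²-b : D ∣ c₀ * c₀ - b) (p∣D : + p ∣ D)
                    (p∣1-2hc₀ : + p ∣ + 1 - (+ 2 * h) * c₀) where

    root : ℕ → ℤ
    root zero    = c₀
    root (suc K) = root K - h * (root K * root K - b)

    private
      invariant : ∀ K → (D * p^ K ∣ root K * root K - b) × (D ∣ root K - c₀)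
      invariant zero = ∣-respˡ-≡ (sym (ℤP.*-identityʳ D)) D∣c₀²-b , ≡⇒∣- {x = c₀} refl
      invariant (suc K) = D*p^K+1∣ , D∣
        where
        t = root K
        ih = invariant K
        rotate : ∀ a b c → a * (b * c) ≡ (a * c) * b
        rotate = solve-∀
        newton-error : ∀ t b h c₀ → (t - h * (t * t - b)) * (t - h * (t * t - b)) - b
          ≡ (t * t - b) * ((+ 1 - (+ 2 * h) * c₀) - (+ 2 * h) * (t - c₀) + (h * h) * (t * t - b))
        newton-error = solve-∀
        shift : ∀ t c₀ u → (t - u) - c₀ ≡ (t - c₀) - u
        shift = solve-∀
        D∣t²-b : D ∣ t * t - b
        D∣t²-b = ∣-trans (divides (p^ K) (ℤP.*-comm D (p^ K))) (proj₁ ih)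
        -- the error term is squared up to a factor divisible by p
        p∣factor : + p ∣ (+ 1 - (+ 2 * h) * c₀) - (+ 2 * h) * (t - c₀) + (h * h) * (t * t - b)
        p∣factor = ∣m∣n⇒∣m+n (∣m∣n⇒∣m-n p∣1-2hc₀ (∣n⇒∣m*n (+ 2 * h) (∣-trans p∣D (proj₂ ih))))
                             (∣n⇒∣m*n (h * h) (∣-trans p∣D D∣t²-b))
        D*p^K+1∣ : D * p^ (suc K) ∣ root (suc K) * root (suc K) - b
        D*p^K+1∣ = ∣-respˡ-≡ (sym (trans (cong (D *_) (p^-suc K)) (rotate D (+ p) (p^ K))))
          (∣-resp-≡ (newton-error t b h c₀) (*-pres-∣ (proj₁ ih) p∣factor))
        D∣ : D ∣ root (suc K) - c₀
        D∣ = ∣-resp-≡ (shift t c₀ (h * (t * t - b))) (∣m∣n⇒∣m-n (proj₂ ih) (∣n⇒∣m*n h D∣t²-b))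

    root-sq : ∀ K → p^ K ∣ root K * root K - b
    root-sq K = ∣-trans (divides D refl) (proj₁ (invariant K))

    root-near-c₀ : ∀ K → D ∣ root K - c₀
    root-near-c₀ K = proj₂ (invariant K)

    root-cauchy : ∀ K → p^ K ∣ root (suc K) - root K
    root-cauchy K = ∣-resp-≡ (step (root K) (h * (root K * root K - b))) (∣m⇒∣-m (∣n⇒∣m*n h (root-sq K)))
      where
      step : ∀ t u → (t - u) - t ≡ - u
      step = solve-∀

  module UnitInverse (V h : ℤ) (p∣1-Vh : + p ∣ + 1 - V * h) where

    inverse : ℕ → ℤ
    inverse zero    = h
    inverse (suc K) = inverse K + h * (+ 1 - V * inverse K)

    private
      p^K+1∣ : ∀ K → p^ (suc K) ∣ + 1 - V * inverse K
      p^K+1∣ zero    = ∣-respˡ-≡ (sym p^-1) p∣1-Vh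
      p^K+1∣ (suc K) = ∣-respˡ-≡ (sym (p^-suc (suc K)))
        (∣-resp-≡ (newton-error V h (inverse K))
          (∣-respˡ-≡ (ℤP.*-comm (p^ (suc K)) (+ p)) (*-pres-∣ (p^K+1∣ K) p∣1-Vh)))
        where
        newton-error : ∀ V h w → + 1 - V * (w + h * (+ 1 - V * w)) ≡ (+ 1 - V * w) * (+ 1 - V * h)
        newton-error = solve-∀

    inverse-spec : ∀ K → p^ K ∣ V * inverse K - + 1
    inverse-spec K = ∣-resp-≡ (flip V (inverse K)) (∣m⇒∣-m (∣-trans (p^∣p^-suc K) (p^K+1∣ K)))
      where
      flip : ∀ V w → V * w - + 1 ≡ - (+ 1 - V * w)
      flip = solve-∀

    inverse-cauchy : ∀ K → p^ K ∣ inverse (suc K) - inverse K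
    inverse-cauchy K = ∣-resp-≡ (step (inverse K) (h * (+ 1 - V * inverse K))) (∣n⇒∣m*n h (∣-trans (p^∣p^-suc K) (p^K+1∣ K)))
      where
      step : ∀ w u → (w + u) - w ≡ u
      step = solve-∀

  -- A complete quotient (P + √b) / Q with Q = pᵉ V, V a p-adic unit with inverse V⁻¹.
  record CFState : Set where
    constructor cfState
    field
      e : ℕ
      pᵉ : ℤ
      pᵉ-spec : p^ e ≡ pᵉ
      P V : ℤ
      V⁻¹ : ℕ → ℤ
      V⁻¹-spec : ∀ K → p^ K ∣ V * V⁻¹ K - + 1
      V⁻¹-cauchy : ∀ K → p^ K ∣ V⁻¹ (suc K) - V⁻¹ K

    Q : ℤ
    Q = pᵉ * V

  open CFState

  initialState : CFState
  initialState = cfState 0 (+ 1) refl (+ 0) (+ 1) (λ _ → + 1) (λ K → ∣0 (p^ K)) (λ K → ∣0 (p^ K))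

  unitState : (e : ℕ) (pᵉ : ℤ) → p^ e ≡ pᵉ → (P V h : ℤ) → + p ∣ + 1 - V * h → CFState
  unitState e pᵉ pᵉ-spec P V h p∣1-Vh = cfState e pᵉ pᵉ-spec P V inverse inverse-spec inverse-cauchy
    where open UnitInverse V h p∣1-Vh

  module Expansion (b : ℤ) (√b : ℕ → ℤ) (√b-sq : ∀ K → p^ K ∣ √b K * √b K - b)
                   (√b-cauchy : ∀ K → p^ K ∣ √b (suc K) - √b K) where

    √bₚ : ℚₚ
    √bₚ = 0 ,ₚ √b

    complete : CFState → ℚₚ
    complete σ = e σ ,ₚ (λ K → (P σ + √b K) * V⁻¹ σ K)

    quotientₚ : ℕ → ℤ → ℚₚ
    quotientₚ f m = f ,ₚ (λ _ → m)

    √bₚ-isQp : IsQp p √bₚ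
    √bₚ-isQp K = p^-∣ᵤ K (√b-cauchy K)

    √bₚ-square : mulₚ √bₚ √bₚ ≈[ p ] ιₚ b
    √bₚ-square K = p^-∣ᵤ K (∣-resp-≡ (unscale (√b K) b) (√b-sq K))
      where
      unscale : ∀ x b → + 1 * (x * x) - + 1 * b ≡ x * x - b
      unscale = solve-∀

    complete-isQp : ∀ σ → IsQp p (complete σ)
    complete-isQp (cfState e _ _ P V w _ w-cauchy) K =
      p^-∣ᵤ K (∣-resp-≡ (split P (√b (suc K)) (√b K) (w (suc K)) (w K))
        (∣m∣n⇒∣m+n (∣m⇒∣m*n (w (suc K)) (√b-cauchy K)) (∣n⇒∣m*n (P + √b K) (w-cauchy K))))
      where
      split : ∀ P s₁ s₀ w₁ w₀ → (P + s₁) * w₁ - (P + s₀) * w₀ ≡ (s₁ - s₀) * w₁ + (P + s₀) * (w₁ - w₀)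
      split = solve-∀

    initial-≈ : complete initialState ≈[ p ] √bₚ
    initial-≈ K = p^-∣ᵤ K (∣-resp-≡ (cancel (√b K)) (∣0 _))
      where
      cancel : ∀ x → + 1 * ((+ 0 + x) * + 1) - + 1 * x ≡ + 0
      cancel = solve-∀

    quotientₚ-isQp : ∀ f m → IsQp p (quotientₚ f m)
    quotientₚ-isQp f m K = p^-∣ᵤ K (≡⇒∣- {x = m} refl)

    quotientₚ-represents : ∀ (a : ℚ) f → ↧ₙ a ≡ p ℕ.^ f → Represents p (quotientₚ f (↥ a)) a
    quotientₚ-represents a f a-den K =
      p^-∣ᵤ K (∣-resp-≡ (trans (cong (λ z → + 1 * (+ z * ↥ a) - p^ f * ↥ a) a-den) (cancel (p^ f) (↥ a))) (∣0 _))
      where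
      cancel : ∀ x m → + 1 * (x * m) - x * m ≡ + 0
      cancel = solve-∀

    complete-step : ∀ (σ σ′ : CFState) f pᶠ m → p^ f ≡ pᶠ →
      CFStep b pᶠ m (Q σ) (Q σ′) (P σ) (P σ′) →
      mulₚ (complete σ′) (subₚ p (complete σ) (quotientₚ f m)) ≈[ p ] ιₚ (+ 1)
    complete-step (cfState e _ refl P V w w-spec _) (cfState e′ _ refl P′ V′ w′ w′-spec _) f _ m refl
                  (recurrence , norm) K =
      p^-∣ᵤ K (∣-resp-≡ (trans (cong (λ z → + 1 * (((P′ + √b K) * w′ K) * (p^ f * ((P + √b K) * w K) - p^ e * m)) - z * + 1)
                                   exponents)
                             (expand (√b K) b P P′ V V′ (w K) (w′ K) (p^ f) (p^ e) (p^ e′) m))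
        (∣m∣n⇒∣m+n (∣m∣n⇒∣m+n (∣m∣n⇒∣m+n (∣m∣n⇒∣m+n (∣m∣n⇒∣m+n
          (∣n⇒∣m*n (w K * w′ K * p^ f) (√b-sq K))
          (∣n⇒∣m*n (p^ e′ * (p^ e * p^ f) * (V′ * w′ K)) (w-spec K)))
          (∣n⇒∣m*n (p^ e′ * (p^ e * p^ f)) (w′-spec K)))
          (∣n⇒∣m*n ((P′ + √b K) * w′ K * p^ e * m) (w-spec K)))
          (∣n⇒∣m*n (w K * w′ K * p^ f) (≡⇒∣- {p^ K} norm)))
          (∣n⇒∣m*n ((P′ + √b K) * w K * w′ K) (≡⇒∣- {p^ K} recurrence))))
      where
      exponents : p^ (e′ ℕ.+ (e ℕ.+ f)) ≡ p^ e′ * (p^ e * p^ f)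
      exponents = trans (p^-+ e′ (e ℕ.+ f)) (cong (p^ e′ *_) (p^-+ e f))
      -- every summand on the right is divisible by p^K: by √b² ≡ b, V w ≡ 1, V′ w′ ≡ 1
      -- or one of the two recurrences
      expand : ∀ (s b P P′ V V′ w w′ ρ σ σ′ m : ℤ) →
        + 1 * (((P′ + s) * w′) * (ρ * ((P + s) * w) - σ * m)) - (σ′ * (σ * ρ)) * + 1
        ≡ w * w′ * ρ * (s * s - b) + (σ′ * (σ * ρ)) * (V′ * w′) * (V * w - + 1)
          + (σ′ * (σ * ρ)) * (V′ * w′ - + 1) + (P′ + s) * w′ * σ * m * (V * w - + 1)
          + w * w′ * ρ * (b - P′ * P′ - (σ * V) * (σ′ * V′))
          + (P′ + s) * w * w′ * (ρ * P′ - (m * (σ * V) - ρ * P))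
      expand = solve-∀

    complete-approx : ∀ (σ : CFState) f pᶠ m P′ → p^ f ≡ pᶠ →
      pᶠ * P′ ≡ m * Q σ - pᶠ * P σ →
      (∀ K → p^ (suc (e σ)) ∣ √b K - P′) →
      AbsP<1 p (subₚ p (complete σ) (quotientₚ f m))
    complete-approx (cfState e _ refl P V w w-spec _) f _ m P′ refl recurrence near =
      p^-∣ᵤ K (∣-resp-≡ (expand (√b K) P P′ V (w K) (p^ f) (p^ e) m)
        (∣m∣n⇒∣m+n (∣m∣n⇒∣m+n
          (∣-respˡ-≡ (sym (trans (p^-+ (suc e) f) (ℤP.*-comm (p^ (suc e)) (p^ f))))
            (∣-resp-≡ (reassoc (w K) (p^ f) (√b K - P′)) (∣n⇒∣m*n (w K) (*-pres-∣ (∣-refl {p^ f}) (near K)))))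
          (∣n⇒∣m*n (p^ e * m) (w-spec K)))
          (∣n⇒∣m*n (w K) (≡⇒∣- {p^ K} recurrence))))
      where
      K = suc (e ℕ.+ f)
      expand : ∀ s P P′ V w ρ σ m → ρ * ((P + s) * w) - σ * m
        ≡ w * ρ * (s - P′) + σ * m * (V * w - + 1) + w * (ρ * P′ - (m * (σ * V) - ρ * P))
      expand = solve-∀
      reassoc : ∀ w ρ x → w * ρ * x ≡ w * (ρ * x)
      reassoc = solve-∀

    -- pᶠ n is p^(f n) in the form used by the recurrences; approx is what makes aₙ = s(Γₙ)
    record ExpansionData : Set where
      field
        state : ℕ → CFState
        a : ℕ → ℚ
        f : ℕ → ℕ
        pᶠ : ℕ → ℤ
        state-zero : state 0 ≡ initialState
        a-den : ∀ n → ↧ₙ (a n) ≡ p ℕ.^ f n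
        pᶠ-spec : ∀ n → p^ (f n) ≡ pᶠ n
        a∈𝒴 : ∀ n → In𝒴 p (a n)
        step : ∀ n → CFStep b (pᶠ n) (↥ (a n)) (Q (state n)) (Q (state (suc n)))
                                               (P (state n)) (P (state (suc n)))
        approx : ∀ n K → p^ (suc (e (state n))) ∣ √b K - P (state (suc n))

    isBrowkinCF : (E : ExpansionData) → IsBrowkinCF p √bₚ (ExpansionData.a E)
    isBrowkinCF E =
      (λ n → complete (state n)) , (λ n → quotientₚ (f n) (↥ (a n))) ,
      subst (λ σ → complete σ ≈[ p ] √bₚ) (sym state-zero) initial-≈ ,
      (λ n → complete-isQp (state n)) ,
      (λ n → quotientₚ-isQp (f n) (↥ (a n)) , quotientₚ-represents (a n) (f n) (a-den n)) ,
      a∈𝒴 ,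
      (λ n → complete-approx (state n) (f n) (pᶠ n) (↥ (a n)) (P (state (suc n))) (pᶠ-spec n)
                             (proj₁ (step n)) (approx n)) ,
      (λ n → complete-step (state n) (state (suc n)) (f n) (pᶠ n) (↥ (a n)) (pᶠ-spec n) (step n))
      where open ExpansionData E

periodLength : ∀ (a t : ℕ → ℚ) k T → (∀ n → a (k ℕ.+ n) ≡ t n) → (∀ n → t (T ℕ.+ n) ≡ t n) →
  (∀ T′ → 0 < T′ → T′ < T → t T′ ≢ t 0) → PeriodLength a T
periodLength a t k T a≡t t-periodic t-distinct = (k , periodic) , minimal
  where
  open ≡-Reasoning

  periodic : ∀ n → k ≤ n → a (n ℕ.+ T) ≡ a n
  periodic n k≤n with j , refl ← ℕP.m≤n⇒∃[o]m+o≡n k≤n = begin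
    a (k ℕ.+ j ℕ.+ T)   ≡⟨ cong a (trans (ℕP.+-assoc k j T) (cong (k ℕ.+_) (ℕP.+-comm j T))) ⟩
    a (k ℕ.+ (T ℕ.+ j)) ≡⟨ a≡t (T ℕ.+ j) ⟩
    t (T ℕ.+ j)         ≡⟨ t-periodic j ⟩
    t j                 ≡⟨ a≡t j ⟨
    a (k ℕ.+ j)         ∎

  t-multiple : ∀ N r → t (N ℕ.* T ℕ.+ r) ≡ t r
  t-multiple zero    r = refl
  t-multiple (suc N) r = trans (cong t (ℕP.+-assoc T (N ℕ.* T) r))
                               (trans (t-periodic (N ℕ.* T ℕ.+ r)) (t-multiple N r))

  minimal : ∀ T′ → 0 < T′ → T′ < T → ¬ HasPeriod a T′
  minimal T′ 0<T′ T′<T (N , H) = t-distinct T′ 0<T′ T′<T (begin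
    t T′                      ≡⟨ t-multiple N T′ ⟨
    t (N ℕ.* T ℕ.+ T′)        ≡⟨ a≡t (N ℕ.* T ℕ.+ T′) ⟨
    a (k ℕ.+ (N ℕ.* T ℕ.+ T′)) ≡⟨ cong a (ℕP.+-assoc k (N ℕ.* T) T′) ⟨
    a (k ℕ.+ N ℕ.* T ℕ.+ T′)  ≡⟨ H (k ℕ.+ N ℕ.* T) N≤ ⟩
    a (k ℕ.+ N ℕ.* T)         ≡⟨ a≡t (N ℕ.* T) ⟩
    t (N ℕ.* T)               ≡⟨ cong t (ℕP.+-identityʳ (N ℕ.* T)) ⟨
    t (N ℕ.* T ℕ.+ 0)         ≡⟨ t-multiple N 0 ⟩
    t 0                       ∎)
    where
    N≤ : N ≤ k ℕ.+ N ℕ.* T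
    N≤ = ℕP.≤-trans (ℕP.m≤m*n N T {{ℕ.>-nonZero (ℕP.<-trans 0<T′ T′<T)}}) (ℕP.m≤n+m (N ℕ.* T) k)

-- Rational expressions, compared by cross-multiplying their naive numerators and
-- denominators (the normalised numerator of a sum or product is not computable
-- symbolically, so the comparison goes through ℚᵘ).
infixl 6 _⊕_
infixl 7 _⊗_

data Expr : Set where
  atom : ℚ → Expr
  _⊕_ _⊗_ : Expr → Expr → Expr
  ⊝_ ∣_∣ₑ : Expr → Expr

⟦_⟧ : Expr → ℚ
⟦ atom x ⟧  = x
⟦ x ⊕ y ⟧   = ⟦ x ⟧ ℚ.+ ⟦ y ⟧
⟦ x ⊗ y ⟧   = ⟦ x ⟧ ℚ.* ⟦ y ⟧
⟦ ⊝ x ⟧     = ℚ.- ⟦ x ⟧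
⟦ ∣ x ∣ₑ ⟧  = ℚ.∣ ⟦ x ⟧ ∣

num den : Expr → ℤ
num (atom x) = ↥ x
num (x ⊕ y)  = num x * den y + num y * den x
num (x ⊗ y)  = num x * num y
num (⊝ x)    = - num x
num ∣ x ∣ₑ   = + ∣ num x ∣
den (atom x) = ↧ x
den (x ⊕ y)  = den x * den y
den (x ⊗ y)  = den x * den y
den (⊝ x)    = den x
den ∣ x ∣ₑ   = den x

private
  ⟦_⟧ᵘ : Expr → ℚᵘ
  ⟦ atom x ⟧ᵘ = toℚᵘ x
  ⟦ x ⊕ y ⟧ᵘ  = ⟦ x ⟧ᵘ ℚᵘ.+ ⟦ y ⟧ᵘ
  ⟦ x ⊗ y ⟧ᵘ  = ⟦ x ⟧ᵘ ℚᵘ.* ⟦ y ⟧ᵘ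
  ⟦ ⊝ x ⟧ᵘ    = ℚᵘ.- ⟦ x ⟧ᵘ
  ⟦ ∣ x ∣ₑ ⟧ᵘ = ℚᵘ.∣ ⟦ x ⟧ᵘ ∣

  toℚᵘ-⟦⟧ : ∀ x → toℚᵘ ⟦ x ⟧ ℚᵘ.≃ ⟦ x ⟧ᵘ
  toℚᵘ-⟦⟧ (atom x) = ℚᵘP.≃-refl
  toℚᵘ-⟦⟧ (x ⊕ y)  = ℚᵘP.≃-trans (ℚP.toℚᵘ-homo-+ ⟦ x ⟧ ⟦ y ⟧) (ℚᵘP.+-cong (toℚᵘ-⟦⟧ x) (toℚᵘ-⟦⟧ y))
  toℚᵘ-⟦⟧ (x ⊗ y)  = ℚᵘP.≃-trans (ℚP.toℚᵘ-homo-* ⟦ x ⟧ ⟦ y ⟧) (ℚᵘP.*-cong (toℚᵘ-⟦⟧ x) (toℚᵘ-⟦⟧ y))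
  toℚᵘ-⟦⟧ (⊝ x)    = ℚᵘP.≃-trans (ℚP.toℚᵘ-homo‿- ⟦ x ⟧) (ℚᵘP.-‿cong (toℚᵘ-⟦⟧ x))
  toℚᵘ-⟦⟧ ∣ x ∣ₑ   = ℚᵘP.≃-trans (ℚP.toℚᵘ-homo-∣-∣ ⟦ x ⟧) (ℚᵘP.∣-∣-cong (toℚᵘ-⟦⟧ x))

  ↥-+ : ∀ X Y → ℚᵘ.↥ (X ℚᵘ.+ Y) ≡ ℚᵘ.↥ X * ℚᵘ.↧ Y + ℚᵘ.↥ Y * ℚᵘ.↧ X
  ↥-+ (mkℚᵘ _ _) (mkℚᵘ _ _) = refl
  ↧-+ : ∀ X Y → ℚᵘ.↧ (X ℚᵘ.+ Y) ≡ ℚᵘ.↧ X * ℚᵘ.↧ Y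
  ↧-+ (mkℚᵘ _ b) (mkℚᵘ _ d) = ℤP.pos-* (suc b) (suc d)
  ↥-* : ∀ X Y → ℚᵘ.↥ (X ℚᵘ.* Y) ≡ ℚᵘ.↥ X * ℚᵘ.↥ Y
  ↥-* (mkℚᵘ _ _) (mkℚᵘ _ _) = refl
  ↧-* : ∀ X Y → ℚᵘ.↧ (X ℚᵘ.* Y) ≡ ℚᵘ.↧ X * ℚᵘ.↧ Y
  ↧-* (mkℚᵘ _ b) (mkℚᵘ _ d) = ℤP.pos-* (suc b) (suc d)
  ↥-neg : ∀ X → ℚᵘ.↥ (ℚᵘ.- X) ≡ - ℚᵘ.↥ X
  ↥-neg (mkℚᵘ _ _) = refl
  ↧-neg : ∀ X → ℚᵘ.↧ (ℚᵘ.- X) ≡ ℚᵘ.↧ X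
  ↧-neg (mkℚᵘ _ _) = refl
  ↥-∣∣ : ∀ X → ℚᵘ.↥ (ℚᵘ.∣ X ∣) ≡ + ∣ ℚᵘ.↥ X ∣
  ↥-∣∣ (mkℚᵘ _ _) = refl
  ↧-∣∣ : ∀ X → ℚᵘ.↧ (ℚᵘ.∣ X ∣) ≡ ℚᵘ.↧ X
  ↧-∣∣ (mkℚᵘ _ _) = refl

  ↥↧-⟦⟧ᵘ : ∀ x → (ℚᵘ.↥ ⟦ x ⟧ᵘ ≡ num x) × (ℚᵘ.↧ ⟦ x ⟧ᵘ ≡ den x)
  ↥↧-⟦⟧ᵘ (atom x) = ℚP.↥ᵘ-toℚᵘ x , ℚP.↧ᵘ-toℚᵘ x
  ↥↧-⟦⟧ᵘ (x ⊕ y) =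
    trans (↥-+ ⟦ x ⟧ᵘ ⟦ y ⟧ᵘ) (cong₂ _+_ (cong₂ _*_ (proj₁ (↥↧-⟦⟧ᵘ x)) (proj₂ (↥↧-⟦⟧ᵘ y)))
                                         (cong₂ _*_ (proj₁ (↥↧-⟦⟧ᵘ y)) (proj₂ (↥↧-⟦⟧ᵘ x)))) ,
    trans (↧-+ ⟦ x ⟧ᵘ ⟦ y ⟧ᵘ) (cong₂ _*_ (proj₂ (↥↧-⟦⟧ᵘ x)) (proj₂ (↥↧-⟦⟧ᵘ y)))
  ↥↧-⟦⟧ᵘ (x ⊗ y) =
    trans (↥-* ⟦ x ⟧ᵘ ⟦ y ⟧ᵘ) (cong₂ _*_ (proj₁ (↥↧-⟦⟧ᵘ x)) (proj₁ (↥↧-⟦⟧ᵘ y))) ,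
    trans (↧-* ⟦ x ⟧ᵘ ⟦ y ⟧ᵘ) (cong₂ _*_ (proj₂ (↥↧-⟦⟧ᵘ x)) (proj₂ (↥↧-⟦⟧ᵘ y)))
  ↥↧-⟦⟧ᵘ (⊝ x) = trans (↥-neg ⟦ x ⟧ᵘ) (cong -_ (proj₁ (↥↧-⟦⟧ᵘ x)))
    , trans (↧-neg ⟦ x ⟧ᵘ) (proj₂ (↥↧-⟦⟧ᵘ x))
  ↥↧-⟦⟧ᵘ ∣ x ∣ₑ = trans (↥-∣∣ ⟦ x ⟧ᵘ) (cong (λ z → + ∣ z ∣) (proj₁ (↥↧-⟦⟧ᵘ x)))
    , trans (↧-∣∣ ⟦ x ⟧ᵘ) (proj₂ (↥↧-⟦⟧ᵘ x))

  cross : Expr → Expr → ℤ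
  cross x y = ℚᵘ.↥ ⟦ x ⟧ᵘ * ℚᵘ.↧ ⟦ y ⟧ᵘ

  cross≡ : ∀ x y → cross x y ≡ num x * den y
  cross≡ x y = cong₂ _*_ (proj₁ (↥↧-⟦⟧ᵘ x)) (proj₂ (↥↧-⟦⟧ᵘ y))

≡-by-cross : ∀ x y → num x * den y ≡ num y * den x → ⟦ x ⟧ ≡ ⟦ y ⟧
≡-by-cross x y h = ℚP.toℚᵘ-injective (ℚᵘP.≃-trans (toℚᵘ-⟦⟧ x)
  (ℚᵘP.≃-trans (*≡* (trans (cross≡ x y) (trans h (sym (cross≡ y x))))) (ℚᵘP.≃-sym (toℚᵘ-⟦⟧ y))))

<-by-cross : ∀ x y → num x * den y ℤ.< num y * den x → ⟦ x ⟧ ℚ.< ⟦ y ⟧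
<-by-cross x y h = ℚP.toℚᵘ-cancel-<
  (ℚᵘP.<-respˡ-≃ (ℚᵘP.≃-sym (toℚᵘ-⟦⟧ x)) (ℚᵘP.<-respʳ-≃ (ℚᵘP.≃-sym (toℚᵘ-⟦⟧ y))
    (*<* (subst₂ ℤ._<_ (sym (cross≡ x y)) (sym (cross≡ y x)) h))))

-- Polynomials with natural coefficients: their values at natural numbers are
-- nonnegative, which turns a polynomial identity into a strict inequality.
infixl 6 _+ₚ_
infixl 7 _*ₚ_

data Poly⁺ : Set where
  var : Poly⁺
  con : ℕ → Poly⁺
  _+ₚ_ _*ₚ_ : Poly⁺ → Poly⁺ → Poly⁺

⟦_⟧⁺ : Poly⁺ → ℕ → ℕ
⟦ var ⟧⁺ r     = r
⟦ con n ⟧⁺ r   = n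
⟦ f +ₚ g ⟧⁺ r  = ⟦ f ⟧⁺ r ℕ.+ ⟦ g ⟧⁺ r
⟦ f *ₚ g ⟧⁺ r  = ⟦ f ⟧⁺ r ℕ.* ⟦ g ⟧⁺ r

⟦_⟧ℤ : Poly⁺ → ℤ → ℤ
⟦ var ⟧ℤ r     = r
⟦ con n ⟧ℤ r   = + n
⟦ f +ₚ g ⟧ℤ r  = ⟦ f ⟧ℤ r + ⟦ g ⟧ℤ r
⟦ f *ₚ g ⟧ℤ r  = ⟦ f ⟧ℤ r * ⟦ g ⟧ℤ r

⟦⟧ℤ-+ : ∀ f r → ⟦ f ⟧ℤ (+ r) ≡ + ⟦ f ⟧⁺ r
⟦⟧ℤ-+ var r       = refl
⟦⟧ℤ-+ (con n) r   = refl
⟦⟧ℤ-+ (f +ₚ g) r  = trans (cong₂ _+_ (⟦⟧ℤ-+ f r) (⟦⟧ℤ-+ g r)) (sym (ℤP.pos-+ (⟦ f ⟧⁺ r) (⟦ g ⟧⁺ r)))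
⟦⟧ℤ-+ (f *ₚ g) r  = trans (cong₂ _*_ (⟦⟧ℤ-+ f r) (⟦⟧ℤ-+ g r)) (sym (ℤP.pos-* (⟦ f ⟧⁺ r) (⟦ g ⟧⁺ r)))

<-by-slack : ∀ x y r f → y ≡ x + (+ 1 + ⟦ f ⟧ℤ (+ r)) → x ℤ.< y
<-by-slack x y r f eq = subst₂ ℤ._<_ (ℤP.+-identityʳ x)
  (sym (trans eq (cong (λ z → x + (+ 1 + z)) (⟦⟧ℤ-+ f r))))
  (ℤP.+-monoʳ-< x (ℤ.+<+ (s≤s z≤n)))

<-by-slackₙ : ∀ a b c → b ≡ suc (a ℕ.+ c) → a < b
<-by-slackₙ a b c eq = subst (suc a ≤_) (sym eq) (ℕP.m≤m+n (suc a) c)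

≤-by-slackₙ : ∀ a b c → b ≡ a ℕ.+ c → a ≤ b
≤-by-slackₙ a b c eq = subst (a ≤_) (sym eq) (ℕP.m≤m+n a c)

/-mkℚ : ∀ (i : ℤ) d .(c : Coprime ∣ i ∣ (suc d)) → i / suc d ≡ mkℚ i d c
/-mkℚ (+ n)    d c = ℚP.normalize-coprime c
/-mkℚ -[1+ n ] d c = cong ℚ.-_ (ℚP.normalize-coprime c)

ℤ→ℚ′ : ℤ → ℚ
ℤ→ℚ′ z = mkℚ z 0 (Coprime.sym (Coprime.1-coprimeTo ∣ z ∣))

ℤ→ℚ≡ℤ→ℚ′ : ∀ z → ℤ→ℚ z ≡ ℤ→ℚ′ z
ℤ→ℚ≡ℤ→ℚ′ z = /-mkℚ z 0 _

ℕ→ℚ≡ℤ→ℚ′ : ∀ n z → + n ≡ z → ℕ→ℚ n ≡ ℤ→ℚ′ z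
ℕ→ℚ≡ℤ→ℚ′ n z refl = ℤ→ℚ≡ℤ→ℚ′ (+ n)

coprime-suc : ∀ n → Coprime n (suc n)
coprime-suc n {d} (d∣n , d∣1+n) =
  ℕD.∣1⇒≡1 (ℕD.∣m+n∣m⇒∣n (subst (d ℕD.∣_) (ℕP.+-comm 1 n) d∣1+n) d∣n)

∣1-n∣ : ∀ m → ∣ + 1 + - (+ suc m) ∣ ≡ m
∣1-n∣ m = ℤP.∣⊖∣-≤ (s≤s z≤n)

module Symmetric𝒴 (p : ℕ) where

  private
    p·1*D≡ : ∀ D → (+ p * + 1) * + D ≡ + (p ℕ.* D)
    p·1*D≡ D = trans (cong (_* + D) (ℤP.*-identityʳ (+ p))) (sym (ℤP.pos-* p D))

    -p·1*D≡ : ∀ D → - (+ p * + 1) * + D ≡ - (+ (p ℕ.* D))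
    -p·1*D≡ D = trans (sym (ℤP.neg-distribˡ-* (+ p * + 1) (+ D))) (cong -_ (p·1*D≡ D))

    neg-<-neg : ∀ K M → K < M → - (+ M) ℤ.< - (+ K)
    neg-<-neg (suc K) (suc M) (s≤s K<M) = ℤ.-<- K<M
    neg-<-neg zero    (suc M) _         = ℤ.-<+

    neg-<-pos : ∀ M k → k < M → - (+ M) ℤ.< + k
    neg-<-pos (suc M) k _ = ℤ.-<+

    -- the two halves of -p/2 < N/D < p/2, cross-multiplied as in Expr
    within-p/2 : ∀ N D → ∣ N ∣ ℕ.* 2 < p ℕ.* D →
      (- (+ p * + 1) * + D ℤ.< N * (+ 1 * + 2)) × (N * (+ 1 * + 2) ℤ.< (+ p * + 1) * + D)
    within-p/2 (+ n) D h =
      subst₂ ℤ._<_ (sym (-p·1*D≡ D)) (ℤP.pos-* n 2) (neg-<-pos (p ℕ.* D) (n ℕ.* 2) h) ,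
      subst₂ ℤ._<_ (ℤP.pos-* n 2) (sym (p·1*D≡ D)) (ℤ.+<+ h)
    within-p/2 -[1+ n ] D h =
      subst₂ ℤ._<_ (sym (-p·1*D≡ D)) -N≡ (neg-<-neg (suc n ℕ.* 2) (p ℕ.* D) h) ,
      subst₂ ℤ._<_ -N≡ (sym (p·1*D≡ D)) ℤ.-<+
      where
      -N≡ : - (+ (suc n ℕ.* 2)) ≡ -[1+ n ] * + 2
      -N≡ = trans (cong -_ (ℤP.pos-* (suc n) 2)) (ℤP.neg-distribˡ-* (+ suc n) (+ 2))

  ∈𝒴 : (x : ℚ) (f : ℕ) → ↧ₙ x ≡ p ℕ.^ f → ∣ ↥ x ∣ ℕ.* 2 < p ℕ.* ↧ₙ x → In𝒴 p x
  ∈𝒴 x f x-den bound = (f , x-den) ,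
    subst (λ z → ℚ.- (z ℚ.* ℚ.½) ℚ.< x) (sym (ℕ→ℚ≡ℤ→ℚ′ p (+ p) refl))
          (<-by-cross (⊝ (atom (ℤ→ℚ′ (+ p)) ⊗ atom ℚ.½)) (atom x) (proj₁ (within-p/2 (↥ x) (↧ₙ x) bound))) ,
    subst (λ z → x ℚ.< z ℚ.* ℚ.½) (sym (ℕ→ℚ≡ℤ→ℚ′ p (+ p) refl))
          (<-by-cross (atom x) (atom (ℤ→ℚ′ (+ p)) ⊗ atom ℚ.½) (proj₂ (within-p/2 (↥ x) (↧ₙ x) bound)))

  coprime-p : Prime p → ∀ {n} → ¬ (p ℕD.∣ n) → Coprime n p
  coprime-p p-prime p∤n {d} (d∣n , d∣p) with prime⇒irreducible p-prime d∣p
  ... | inj₁ d≡1 = d≡1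
  ... | inj₂ refl = ⊥-elim (p∤n d∣n)

  coprime-p^ : Prime p → ∀ {n} → ¬ (p ℕD.∣ n) → ∀ f → Coprime n (p ℕ.^ f)
  coprime-p^ p-prime p∤n zero    (d∣n , d∣1)  = ℕD.∣1⇒≡1 d∣1
  coprime-p^ p-prime p∤n (suc f) (d∣n , d∣pᶠ⁺¹) =
    coprime-p^ p-prime p∤n f (d∣n , Coprime.coprime-divisor
      (λ (e∣d , e∣p) → coprime-p p-prime p∤n (ℕD.∣-trans e∣d d∣n , e∣p)) d∣pᶠ⁺¹)

  p∤ : ∀ {n} → 0 < n → n < p → ¬ (p ℕD.∣ n)
  p∤ {suc n} _ n<p p∣n = ℕP.<⇒≱ n<p (ℕD.∣⇒≤ p∣n)

PeriodSixRoot : ℕ → ℕ → Set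
PeriodSixRoot p N = Σ ℤ λ b → N ≤ ∣ b ∣ × Σ ℚₚ λ γ → IsQp p γ × (mulₚ γ γ ≈[ p ] ιₚ b) ×
                    Σ (ℕ → ℚ) λ a → IsBrowkinCF p γ a × PeriodLength a 6


record CrossFacts (P R nA₁ dA₁ nA₂ dA₂ nB₂ dB₂ : ℤ) : Set where
  field
    A₂-scaled      : (nA₂ * (P * P * P)) * + 1 ≡ (P * P * P + P * P + + 1) * (dA₂ * + 1)
    B₂-scaled      : (nB₂ * (P * P)) * + 1 ≡ + 1 * (dB₂ * + 1)
    A₁-positive    : nA₁ * + 1 ≡ + 0 * dA₁ + (+ 1 + (+ 6 + + 10 * R + + 4 * R * R))
    A₂-positive    : nA₂ * + 1 ≡ + 0 * dA₂
                       + (+ 1 + (+ 110 + + 272 * R + + 252 * R * R + + 104 * R * R * R + + 16 * R * R * R * R))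
    growth-cross   : (P * nA₂) * (+ 1 * dA₁) ≡ (+ 4 * nA₁) * (+ 1 * dA₂)
                       + (+ 1 + (+ 728 + + 4050 * R + + 9504 * R * R + + 12312 * R * R * R + + 9552 * R * R * R * R
                                 + + 4448 * R * R * R * R * R + + 1152 * R * R * R * R * R * R
                                 + + 128 * R * R * R * R * R * R * R))
    a₀-small-cross : P * (P * + 1) ≡ (+ 1 * + 4) * + 1 + (+ 1 + (+ 4 + + 12 * R + + 4 * R * R))

module Niceness (r : ℕ) where

  q m p : ℕ
  q = suc r
  m = q ℕ.+ q
  p = suc m

  P : ℤ
  P = + p

  P≡ : P ≡ + 3 + + 2 * + r
  P≡ = trans (cong +_ (p≡ r)) (trans (ℤP.pos-+ 3 (2 ℕ.* r)) (cong (_+_ (+ 3)) (ℤP.pos-* 2 r)))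
    where
    p≡ : ∀ r → suc (suc r ℕ.+ suc r) ≡ 3 ℕ.+ 2 ℕ.* r
    p≡ = ℕ-Solver.solve-∀

  -- the ring solver sees p only as the polynomial 3 + 2R in a variable R
  at-odd : (F : ℤ → ℤ → Set) → (∀ R → F (+ 3 + + 2 * R) R) → F P (+ r)
  at-odd F F-odd = subst (λ z → F z (+ r)) (sym P≡) (F-odd (+ r))

  a₀ a₁ a₂ : ℚ
  a₀ = mkℚ (+ 1) m (Coprime.1-coprimeTo p)
  a₁ = mkℚ (+ 1 + - P) m (subst (λ z → Coprime z p) (sym (∣1-n∣ m)) (coprime-suc m))
  a₂ = mkℚ (+ 1 + P) m (Coprime.sym (coprime-suc p))

  digits≡ : ((+ 1) /ℕ p) ∷ ((+ 1 + - (+ p)) /ℕ p) ∷ ((+ 1 + + p) /ℕ p) ∷ [] ≡ a₀ ∷ a₁ ∷ a₂ ∷ []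
  digits≡ = cong₂ _∷_ a₀≡ (cong₂ _∷_ a₁≡ (cong (_∷ []) a₂≡))
    where
    a₀≡ : (+ 1) /ℕ p ≡ a₀
    a₀≡ = /-mkℚ (+ 1) m _
    a₁≡ : (+ 1 + - P) /ℕ p ≡ a₁
    a₁≡ = /-mkℚ (+ 1 + - P) m _
    a₂≡ : (+ 1 + P) /ℕ p ≡ a₂
    a₂≡ = /-mkℚ (+ 1 + P) m _

  A₀ A₁ A₂ B₀ B₁ B₂ : Expr
  A₀ = atom a₀ ⊗ atom ℚ.1ℚ ⊕ atom ℚ.0ℚ
  A₁ = atom a₁ ⊗ A₀ ⊕ atom ℚ.1ℚ
  A₂ = atom a₂ ⊗ A₁ ⊕ A₀
  B₀ = atom a₀ ⊗ atom ℚ.0ℚ ⊕ atom ℚ.1ℚ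
  B₁ = atom a₁ ⊗ B₀ ⊕ atom ℚ.0ℚ
  B₂ = atom a₂ ⊗ B₁ ⊕ B₀

  p^-ℤ : ∀ k → + (p ℕ.^ suc k) ≡ P * + (p ℕ.^ k)
  p^-ℤ k = ℤP.pos-* p (p ℕ.^ k)

  -- Expr's numerators and denominators of the convergents A₀ … B₂ (the digits have
  -- denominator P = p), fed to ≡-by-cross, <-by-cross and <-by-slack
  CrossForms : ℤ → ℤ → Set
  CrossForms P R =
    let nA₀ = (+ 1 * + 1) * + 1 + + 0 * (P * + 1)
        dA₀ = (P * + 1) * + 1
        nA₁ = ((+ 1 + - P) * nA₀) * + 1 + + 1 * (P * dA₀)
        dA₁ = (P * dA₀) * + 1
        nA₂ = ((+ 1 + P) * nA₁) * dA₀ + nA₀ * (P * dA₁)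
        dA₂ = (P * dA₁) * dA₀
        nB₀ = (+ 1 * + 0) * + 1 + + 1 * (P * + 1)
        dB₀ = (P * + 1) * + 1
        nB₁ = ((+ 1 + - P) * nB₀) * + 1 + + 0 * (P * dB₀)
        dB₁ = (P * dB₀) * + 1
        nB₂ = ((+ 1 + P) * nB₁) * dB₀ + nB₀ * (P * dB₁)
        dB₂ = (P * dB₁) * dB₀
    in CrossFacts P R nA₁ dA₁ nA₂ dA₂ nB₂ dB₂

  cross-facts : CrossForms P (+ r)
  cross-facts = at-odd CrossForms (λ R → record
    { A₂-scaled = solve (R ∷ []) ; B₂-scaled = solve (R ∷ []) ; A₁-positive = solve (R ∷ [])
    ; A₂-positive = solve (R ∷ []) ; growth-cross = solve (R ∷ []) ; a₀-small-cross = solve (R ∷ []) })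

  open CrossFacts cross-facts

  A₁-pos : ℚ.0ℚ ℚ.< ⟦ A₁ ⟧
  A₁-pos = <-by-cross (atom ℚ.0ℚ) A₁ (<-by-slack _ _ r (con 6 +ₚ con 10 *ₚ var +ₚ con 4 *ₚ var *ₚ var) A₁-positive)

  A₂-pos : ℚ.0ℚ ℚ.< ⟦ A₂ ⟧
  A₂-pos = <-by-cross (atom ℚ.0ℚ) A₂
    (<-by-slack _ _ r (con 110 +ₚ con 272 *ₚ var +ₚ con 252 *ₚ var *ₚ var +ₚ con 104 *ₚ var *ₚ var *ₚ var
                         +ₚ con 16 *ₚ var *ₚ var *ₚ var *ₚ var)
                A₂-positive)

  growth : ℕ→ℚ 4 ℚ.* ℚ.∣ ⟦ A₁ ⟧ ∣ ℚ.< ℕ→ℚ p ℚ.* ℚ.∣ ⟦ A₂ ⟧ ∣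
  growth =
    subst (λ z → ℕ→ℚ 4 ℚ.* z ℚ.< ℕ→ℚ p ℚ.* ℚ.∣ ⟦ A₂ ⟧ ∣) (sym (ℚP.0≤p⇒∣p∣≡p (ℚP.<⇒≤ A₁-pos)))
      (subst (λ z → ℕ→ℚ 4 ℚ.* ⟦ A₁ ⟧ ℚ.< ℕ→ℚ p ℚ.* z) (sym (ℚP.0≤p⇒∣p∣≡p (ℚP.<⇒≤ A₂-pos)))
        (subst (λ z → ℕ→ℚ 4 ℚ.* ⟦ A₁ ⟧ ℚ.< z ℚ.* ⟦ A₂ ⟧) (sym (ℕ→ℚ≡ℤ→ℚ′ p P refl))
          (<-by-cross (atom (ℕ→ℚ 4) ⊗ A₁) (atom (ℤ→ℚ′ P) ⊗ A₂)
            (<-by-slack _ _ r (con 728 +ₚ con 4050 *ₚ var +ₚ con 9504 *ₚ var *ₚ var +ₚ con 12312 *ₚ var *ₚ var *ₚ var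
                                 +ₚ con 9552 *ₚ var *ₚ var *ₚ var *ₚ var +ₚ con 4448 *ₚ var *ₚ var *ₚ var *ₚ var *ₚ var
                                 +ₚ con 1152 *ₚ var *ₚ var *ₚ var *ₚ var *ₚ var *ₚ var
                                 +ₚ con 128 *ₚ var *ₚ var *ₚ var *ₚ var *ₚ var *ₚ var *ₚ var)
                        growth-cross))))

  a₀-small : ℚ.∣ a₀ ∣ ℚ.* ℕ→ℚ 4 ℚ.< ℕ→ℚ p
  a₀-small = subst (λ z → ℚ.∣ a₀ ∣ ℚ.* ℕ→ℚ 4 ℚ.< z) (sym (ℕ→ℚ≡ℤ→ℚ′ p P refl))
    (<-by-cross (∣ atom a₀ ∣ₑ ⊗ atom (ℕ→ℚ 4)) (atom (ℤ→ℚ′ P))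
      (<-by-slack _ _ r (con 4 +ₚ con 12 *ₚ var +ₚ con 4 *ₚ var *ₚ var) a₀-small-cross))

  Ã : ℤ
  Ã = P * P * P + P * P + + 1

  A₂-tilde : ⟦ A₂ ⟧ ℚ.* ℕ→ℚ (p ℕ.^ 3) ≡ ℤ→ℚ Ã
  A₂-tilde = subst₂ (λ u v → ⟦ A₂ ⟧ ℚ.* u ≡ v) (sym (ℕ→ℚ≡ℤ→ℚ′ (p ℕ.^ 3) (P * P * P) p³≡))
             (sym (ℤ→ℚ≡ℤ→ℚ′ Ã))
    (≡-by-cross (A₂ ⊗ atom (ℤ→ℚ′ (P * P * P))) (atom (ℤ→ℚ′ Ã)) A₂-scaled)
    where
    p³≡ : + (p ℕ.^ 3) ≡ P * P * P
    p³≡ = trans (p^-ℤ 2) (trans (cong (P *_) (trans (p^-ℤ 1) (cong (P *_) (trans (p^-ℤ 0) (ℤP.*-identityʳ P)))))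
                                (sym (ℤP.*-assoc P P P)))

  B₂-tilde : ⟦ B₂ ⟧ ℚ.* ℕ→ℚ (p ℕ.^ 2) ≡ ℤ→ℚ (+ 1)
  B₂-tilde = subst₂ (λ u v → ⟦ B₂ ⟧ ℚ.* u ≡ v) (sym (ℕ→ℚ≡ℤ→ℚ′ (p ℕ.^ 2) (P * P) p²≡))
             (sym (ℤ→ℚ≡ℤ→ℚ′ (+ 1)))
    (≡-by-cross (B₂ ⊗ atom (ℤ→ℚ′ (P * P))) (atom (ℤ→ℚ′ (+ 1))) B₂-scaled)
    where
    p²≡ : + (p ℕ.^ 2) ≡ P * P
    p²≡ = trans (p^-ℤ 1) (cong (P *_) (trans (p^-ℤ 0) (ℤP.*-identityʳ P)))

  p∤Ã : ¬ ((+ p) ℤᵘ.∣ Ã)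
  p∤Ã p∣Ã = ℕP.<⇒≢ (s≤s (s≤s z≤n)) (sym (ℕD.∣1⇒≡1 (∣⇒∣ᵤ {+ p} {+ 1}
    (∣m+n∣m⇒∣n (ℤD.∣ᵤ⇒∣ p∣Ã) (∣-resp-≡ (factor P) (∣n⇒∣m*n (P * P + P) (∣-refl {P})))))))
    where
    factor : ∀ P → P * P * P + P * P ≡ (P * P + P) * P
    factor = solve-∀

  open Symmetric𝒴 p

  a∈𝒴 : ∀ x → ↧ₙ x ≡ suc m → ∣ ↥ x ∣ ℕ.* 2 < p ℕ.* suc m → In𝒴 p x
  a∈𝒴 x x-den bound =
    ∈𝒴 x 1 (trans x-den (sym (ℕP.*-identityʳ p))) (subst (λ d → ∣ ↥ x ∣ ℕ.* 2 < p ℕ.* d) (sym x-den) bound)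

  nice : Nice p (((+ 1) /ℕ p) ∷ ((+ 1 + - (+ p)) /ℕ p) ∷ ((+ 1 + + p) /ℕ p) ∷ [])
  nice = subst (Nice p) (sym digits≡) (
    (a∈𝒴 a₀ refl a₀-bound , (a∈𝒴 a₁ refl a₁-bound , ℕD.∣-refl)
     All.∷ (a∈𝒴 a₂ refl a₂-bound , ℕD.∣-refl) All.∷ All.[]) ,
    (ℕD.∣-refl , a₀-small) ,
    ((λ A₁≡0 → ℚP.<-irrefl (sym A₁≡0) A₁-pos) , growth) ,
    (Ã , + 1 , (p∤Ã , 3 , inj₁ A₂-tilde) ,
     ((λ p∣1 → ℕP.<⇒≢ (s≤s (s≤s z≤n)) (sym (ℕD.∣1⇒≡1 p∣1))) , 2 , inj₁ B₂-tilde) ,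
     + 1 , ℕD.∣-refl , ℕD.∣-refl , 0 , (ℕD._∣0 ∣ Ã * Ã ∣)))
    where
    a₀-bound : 1 ℕ.* 2 < p ℕ.* suc m
    a₀-bound = <-by-slackₙ _ _ (4 ℕ.* r ℕ.* r ℕ.+ 12 ℕ.* r ℕ.+ 6) (square r)
      where
      square : ∀ r → suc (suc r ℕ.+ suc r) ℕ.* suc (suc r ℕ.+ suc r) ≡ suc (1 ℕ.* 2 ℕ.+ (4 ℕ.* r ℕ.* r ℕ.+ 12 ℕ.* r ℕ.+ 6))
      square = ℕ-Solver.solve-∀
    a₁-bound : ∣ + 1 + - P ∣ ℕ.* 2 < p ℕ.* suc m
    a₁-bound rewrite ∣1-n∣ m = <-by-slackₙ _ _ (4 ℕ.* r ℕ.* r ℕ.+ 8 ℕ.* r ℕ.+ 4) (square r)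
      where
      square : ∀ r → suc (suc r ℕ.+ suc r) ℕ.* suc (suc r ℕ.+ suc r)
                       ≡ suc ((suc r ℕ.+ suc r) ℕ.* 2 ℕ.+ (4 ℕ.* r ℕ.* r ℕ.+ 8 ℕ.* r ℕ.+ 4))
      square = ℕ-Solver.solve-∀
    a₂-bound : ∣ + 1 + P ∣ ℕ.* 2 < p ℕ.* suc m
    a₂-bound = <-by-slackₙ _ _ (4 ℕ.* r ℕ.* r ℕ.+ 8 ℕ.* r) (square r)
      where
      square : ∀ r → suc (suc r ℕ.+ suc r) ℕ.* suc (suc r ℕ.+ suc r)
                       ≡ suc ((suc (suc (suc r ℕ.+ suc r))) ℕ.* 2 ℕ.+ (4 ℕ.* r ℕ.* r ℕ.+ 8 ℕ.* r))
      square = ℕ-Solver.solve-∀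

record LargePrimeCycle (Q : ℤ) : Set where
  field
    p G² D L b T Z P₂ P₃ P₄ : ℤ
    T-root : D ∣ T * T - b
    newton : p ∣ + 1 - (+ 2 * - + 1) * T
    unit₁  : p ∣ + 1 - (- Z) * + 2
    unit₂  : p ∣ + 1 - (- (Z + + 1)) * - + 2
    unit₃  : p ∣ + 1 - Z * - + 2
    unit₄  : p ∣ + 1 - (Z + + 1) * + 2
    step₀  : CFStep b (+ 1) Q (+ 1 * + 1) (p * - Z) (+ 0) Q
    step₁  : CFStep b p (- + 2) (p * - Z) (G² * + 1) Q P₂
    step₂  : CFStep b G² (- + 1) (G² * + 1) (p * - (Z + + 1)) P₂ P₃
    step₃  : CFStep b p (+ 1 - (Q + Q)) (p * - (Z + + 1)) (p * Z) P₃ P₄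
    step₄  : CFStep b p (Q + Q + + 3) (p * Z) (G² * - + 1) P₄ P₂
    step₅  : CFStep b G² (+ 1) (G² * - + 1) (p * (Z + + 1)) P₂ P₃
    step₆  : CFStep b p (Q + Q - + 1) (p * (Z + + 1)) (p * - Z) P₃ P₄
    step₇  : CFStep b p (- (Q + Q + + 3)) (p * - Z) (G² * + 1) P₄ P₂
    approx₀ : p ∣ T - Q
    approx₁ : p * G² ∣ T - P₂
    approx₂ : p * G² ∣ T - P₃
    approx₃ : p * p ∣ T - P₄

-- p = 2Q + 1 and G = 2g + 1; b = -L(L + 1) with 2L + 1 = pG, so that 1 - 4b = (pG)²
-- and T = -2b is a square root of b modulo (pG)².
largePrimeCycle : (Q g : ℤ) → LargePrimeCycle Q
largePrimeCycle Q g =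
  let p  = + 1 + + 2 * Q
      G  = + 1 + + 2 * g
      L  = p * g + Q
      W  = + 2 * g * (g + + 1) + + 1
      Z  = Q * W + g * (g + + 1)
      P₂ = Q * (G * G) + + 2 * g * (g + + 1)
  in record
  { p = p ; G² = G * G ; D = (p * G) * (p * G) ; L = L ; b = - (L * (L + + 1)) ; T = + 2 * L * (L + + 1)
  ; Z = Z ; P₂ = P₂ ; P₃ = - + 1 - P₂ ; P₄ = + 2 * Q * (Q + + 1) * W + g * (g + + 1)
  ; T-root  = divides (L * (L + + 1)) (solve (Q ∷ g ∷ []))
  ; newton  = divides (p * (G * G)) (solve (Q ∷ g ∷ []))
  ; unit₁   = divides W (solve (Q ∷ g ∷ []))
  ; unit₂   = divides (- W) (solve (Q ∷ g ∷ []))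
  ; unit₃   = divides W (solve (Q ∷ g ∷ []))
  ; unit₄   = divides (- W) (solve (Q ∷ g ∷ []))
  ; step₀   = solve (Q ∷ g ∷ []) , solve (Q ∷ g ∷ [])
  ; step₁   = solve (Q ∷ g ∷ []) , solve (Q ∷ g ∷ [])
  ; step₂   = solve (Q ∷ g ∷ []) , solve (Q ∷ g ∷ [])
  ; step₃   = solve (Q ∷ g ∷ []) , solve (Q ∷ g ∷ [])
  ; step₄   = solve (Q ∷ g ∷ []) , solve (Q ∷ g ∷ [])
  ; step₅   = solve (Q ∷ g ∷ []) , solve (Q ∷ g ∷ [])
  ; step₆   = solve (Q ∷ g ∷ []) , solve (Q ∷ g ∷ [])
  ; step₇   = solve (Q ∷ g ∷ []) , solve (Q ∷ g ∷ [])
  ; approx₀ = divides (+ 2 * p * g * g + + 4 * g * Q + + 2 * g + Q) (solve (Q ∷ g ∷ []))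
  ; approx₁ = divides Q (solve (Q ∷ g ∷ []))
  ; approx₂ = divides (Q + + 1) (solve (Q ∷ g ∷ []))
  ; approx₃ = divides (g * (g + + 1)) (solve (Q ∷ g ∷ []))
  }

-- (p^(k+1) - 1)/2 for p = 2q + 1
halfPower : ℕ → ℕ → ℕ
halfPower q zero    = q
halfPower q (suc k) = q ℕ.* (halfPower q k ℕ.+ halfPower q k) ℕ.+ q ℕ.+ halfPower q k

module LargePrimeFamily (q′ n : ℕ) (p-prime : Prime (suc (suc (suc q′) ℕ.+ suc (suc q′)))) where

  q p : ℕ
  q = suc (suc q′)
  p = suc (q ℕ.+ q)

  open PAdic p
  open Symmetric𝒴 p

  g eG dG : ℕ
  g  = halfPower q n
  eG = suc (suc (n ℕ.+ n))
  dG = (g ℕ.+ g) ℕ.* suc (g ℕ.+ g) ℕ.+ (g ℕ.+ g)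

  open LargePrimeCycle (largePrimeCycle (+ q) (+ g)) renaming (p to pℤ)

  p^suc≡ : ∀ k → p ℕ.^ suc k ≡ suc (halfPower q k ℕ.+ halfPower q k)
  p^suc≡ zero    = ℕP.*-identityʳ p
  p^suc≡ (suc k) = trans (cong (p ℕ.*_) (p^suc≡ k)) (expand q (halfPower q k))
    where
    expand : ∀ q g → suc (q ℕ.+ q) ℕ.* suc (g ℕ.+ g)
                     ≡ suc ((q ℕ.* (g ℕ.+ g) ℕ.+ q ℕ.+ g) ℕ.+ (q ℕ.* (g ℕ.+ g) ℕ.+ q ℕ.+ g))
    expand = ℕ-Solver.solve-∀

  odd≡ : ∀ k → + suc (k ℕ.+ k) ≡ + 1 + + 2 * + k
  odd≡ k = trans (ℤP.pos-+ 1 (k ℕ.+ k)) (cong (_+_ (+ 1)) (trans (cong +_ (double k)) (ℤP.pos-* 2 k)))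
    where
    double : ∀ k → k ℕ.+ k ≡ 2 ℕ.* k
    double = ℕ-Solver.solve-∀

  p^1≡ : p^ 1 ≡ pℤ
  p^1≡ = trans p^-1 (odd≡ q)

  p^eG≡ : p^ eG ≡ G²
  p^eG≡ = trans (cong p^_ (sym (cong suc (ℕP.+-suc n n))))
                (trans (p^-+ (suc n) (suc n)) (cong₂ _*_ G≡ G≡))
    where
    G≡ : p^ (suc n) ≡ + 1 + + 2 * + g
    G≡ = trans (cong +_ (p^suc≡ n)) (odd≡ g)

  p^1+eG≡ : p^ (suc eG) ≡ pℤ * G²
  p^1+eG≡ = trans (p^-+ 1 eG) (cong₂ _*_ p^1≡ p^eG≡)

  p^2≡ : p^ 2 ≡ pℤ * pℤ
  p^2≡ = trans (p^-+ 1 1) (cong₂ _*_ p^1≡ p^1≡)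

  D≡ : p^ (suc (suc eG)) ≡ D
  D≡ = trans (p^-+ 2 eG) (trans (cong₂ _*_ p^2≡ p^eG≡) (regroup pℤ (+ 1 + + 2 * + g)))
    where
    regroup : ∀ a b → (a * a) * (b * b) ≡ (a * b) * (a * b)
    regroup = solve-∀

  p∣ : ∀ {x} → pℤ ∣ x → + p ∣ x
  p∣ = ∣-respˡ-≡ (sym (trans (sym p^-1) p^1≡))

  open NewtonSqrt b T (- + 1) D T-root (subst (+ p ∣_) D≡ (p∣p^-suc (suc eG))) (p∣ newton)

  near : ∀ k K P′ → p^ k ∣ p^ (suc (suc eG)) → p^ k ∣ T - P′ → p^ k ∣ root K - P′
  near k K P′ k∣D k∣T-P′ = ∣-via {x = root K} {y = T} (∣-trans (subst (p^ k ∣_) D≡ k∣D) (root-near-c₀ K)) k∣T-P′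

  st₁ st₂ st₃ st₄ st₅ st₆ st₇ : CFState
  st₁ = unitState 1 pℤ p^1≡ (+ q) (- Z) (+ 2) (p∣ unit₁)
  st₂ = unitState eG G² p^eG≡ P₂ (+ 1) (+ 1) (∣0 (+ p))
  st₃ = unitState 1 pℤ p^1≡ P₃ (- (Z + + 1)) (- + 2) (p∣ unit₂)
  st₄ = unitState 1 pℤ p^1≡ P₄ Z (- + 2) (p∣ unit₃)
  st₅ = unitState eG G² p^eG≡ P₂ (- + 1) (- + 1) (∣0 (+ p))
  st₆ = unitState 1 pℤ p^1≡ P₃ (Z + + 1) (+ 2) (p∣ unit₄)
  st₇ = unitState 1 pℤ p^1≡ P₄ (- Z) (+ 2) (p∣ unit₁)

  p∤2 : ¬ (p ℕD.∣ 2)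
  p∤2 = p∤ (s≤s z≤n) (s≤s (s≤s (s≤s z≤n)))

  p∤2q-1 : ¬ (p ℕD.∣ suc (q′ ℕ.+ q))
  p∤2q-1 = p∤ (s≤s z≤n) (s≤s (s≤s (ℕP.n≤1+n _)))

  p∤2q+3 : ¬ (p ℕD.∣ (q ℕ.+ q ℕ.+ 3))
  p∤2q+3 p∣2q+3 = p∤2 (ℕD.∣m+n∣m⇒∣n (subst (p ℕD.∣_) (shift q) p∣2q+3) ℕD.∣-refl)
    where
    shift : ∀ q → q ℕ.+ q ℕ.+ 3 ≡ suc (q ℕ.+ q) ℕ.+ 2
    shift = ℕ-Solver.solve-∀

  a₀ a₁ a₂ a₃ a₄ a₅ a₆ a₇ : ℚ
  a₀ = mkℚ (+ q) 0 (Coprime.sym (Coprime.1-coprimeTo q))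
  a₁ = mkℚ (- + 2) (q ℕ.+ q) (coprime-p p-prime p∤2)
  a₂ = mkℚ (- + 1) dG (Coprime.1-coprimeTo _)
  a₃ = mkℚ (+ 1 - (+ q + + q)) (q ℕ.+ q)
           (subst (λ z → Coprime z p) (sym (∣1-n∣ (suc (q′ ℕ.+ q)))) (coprime-p p-prime p∤2q-1))
  a₄ = mkℚ (+ q + + q + + 3) (q ℕ.+ q) (coprime-p p-prime p∤2q+3)
  a₅ = mkℚ (+ 1) dG (Coprime.1-coprimeTo _)
  a₆ = mkℚ (+ q + + q - + 1) (q ℕ.+ q) (coprime-p p-prime p∤2q-1)
  a₇ = mkℚ (- (+ q + + q + + 3)) (q ℕ.+ q) (coprime-p p-prime p∤2q+3)

  state : ℕ → CFState
  state 0 = initialState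
  state 1 = st₁
  state 2 = st₂
  state 3 = st₃
  state 4 = st₄
  state 5 = st₅
  state 6 = st₆
  state 7 = st₇
  state (suc (suc (suc (suc (suc (suc (suc (suc k)))))))) = state (suc (suc k))

  a : ℕ → ℚ
  a 0 = a₀
  a 1 = a₁
  a 2 = a₂
  a 3 = a₃
  a 4 = a₄
  a 5 = a₅
  a 6 = a₆
  a 7 = a₇
  a (suc (suc (suc (suc (suc (suc (suc (suc k)))))))) = a (suc (suc k))

  f : ℕ → ℕ
  f 0 = 0
  f 1 = 1
  f 2 = eG
  f 3 = 1
  f 4 = 1
  f 5 = eG
  f 6 = 1
  f 7 = 1
  f (suc (suc (suc (suc (suc (suc (suc (suc k)))))))) = f (suc (suc k))

  pᶠ : ℕ → ℤ
  pᶠ 0 = + 1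
  pᶠ 1 = pℤ
  pᶠ 2 = G²
  pᶠ 3 = pℤ
  pᶠ 4 = pℤ
  pᶠ 5 = G²
  pᶠ 6 = pℤ
  pᶠ 7 = pℤ
  pᶠ (suc (suc (suc (suc (suc (suc (suc (suc k)))))))) = pᶠ (suc (suc k))

  dG≡ : suc dG ≡ p ℕ.^ eG
  dG≡ = sym (trans (cong (p ℕ.^_) (sym (cong suc (ℕP.+-suc n n))))
              (trans (ℕP.^-distribˡ-+-* p (suc n) (suc n)) (trans (cong₂ ℕ._*_ (p^suc≡ n) (p^suc≡ n)) (square g))))
    where
    square : ∀ g → suc (g ℕ.+ g) ℕ.* suc (g ℕ.+ g) ≡ suc ((g ℕ.+ g) ℕ.* suc (g ℕ.+ g) ℕ.+ (g ℕ.+ g))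
    square = ℕ-Solver.solve-∀

  p≡p^1 : suc (q ℕ.+ q) ≡ p ℕ.^ 1
  p≡p^1 = sym (ℕP.*-identityʳ p)

  a-den : ∀ n → ↧ₙ (a n) ≡ p ℕ.^ f n
  a-den 0 = refl
  a-den 1 = p≡p^1
  a-den 2 = dG≡
  a-den 3 = p≡p^1
  a-den 4 = p≡p^1
  a-den 5 = dG≡
  a-den 6 = p≡p^1
  a-den 7 = p≡p^1
  a-den (suc (suc (suc (suc (suc (suc (suc (suc k)))))))) = a-den (suc (suc k))

  pᶠ-spec : ∀ n → p^ (f n) ≡ pᶠ n
  pᶠ-spec 0 = refl
  pᶠ-spec 1 = p^1≡
  pᶠ-spec 2 = p^eG≡
  pᶠ-spec 3 = p^1≡
  pᶠ-spec 4 = p^1≡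
  pᶠ-spec 5 = p^eG≡
  pᶠ-spec 6 = p^1≡
  pᶠ-spec 7 = p^1≡
  pᶠ-spec (suc (suc (suc (suc (suc (suc (suc (suc k)))))))) = pᶠ-spec (suc (suc k))

  1/G²-bound : 1 ℕ.* 2 < p ℕ.* suc dG
  1/G²-bound = <-by-slackₙ _ _ (2 ℕ.* q′ ℕ.* dG ℕ.+ 5 ℕ.* dG ℕ.+ 2 ℕ.* q′ ℕ.+ 2) (bound q′ dG)
    where
    bound : ∀ q′ d → suc (suc (suc q′) ℕ.+ suc (suc q′)) ℕ.* suc d
                     ≡ suc (1 ℕ.* 2 ℕ.+ (2 ℕ.* q′ ℕ.* d ℕ.+ 5 ℕ.* d ℕ.+ 2 ℕ.* q′ ℕ.+ 2))
    bound = ℕ-Solver.solve-∀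

  2q-1-bound : suc (q′ ℕ.+ q) ℕ.* 2 < p ℕ.* suc (q ℕ.+ q)
  2q-1-bound = <-by-slackₙ _ _ (4 ℕ.* q′ ℕ.* q′ ℕ.+ 16 ℕ.* q′ ℕ.+ 18) (bound q′)
    where
    bound : ∀ q′ → suc (suc (suc q′) ℕ.+ suc (suc q′)) ℕ.* suc (suc (suc q′) ℕ.+ suc (suc q′))
                   ≡ suc (suc (q′ ℕ.+ suc (suc q′)) ℕ.* 2 ℕ.+ (4 ℕ.* q′ ℕ.* q′ ℕ.+ 16 ℕ.* q′ ℕ.+ 18))
    bound = ℕ-Solver.solve-∀

  2q+3-bound : (q ℕ.+ q ℕ.+ 3) ℕ.* 2 < p ℕ.* suc (q ℕ.+ q)
  2q+3-bound = <-by-slackₙ _ _ (4 ℕ.* q′ ℕ.* q′ ℕ.+ 16 ℕ.* q′ ℕ.+ 10) (bound q′)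
    where
    bound : ∀ q′ → suc (suc (suc q′) ℕ.+ suc (suc q′)) ℕ.* suc (suc (suc q′) ℕ.+ suc (suc q′))
                   ≡ suc ((suc (suc q′) ℕ.+ suc (suc q′) ℕ.+ 3) ℕ.* 2 ℕ.+ (4 ℕ.* q′ ℕ.* q′ ℕ.+ 16 ℕ.* q′ ℕ.+ 10))
    bound = ℕ-Solver.solve-∀

  p²∣T-P₂ : p^ 2 ∣ T - P₂
  p²∣T-P₂ = ∣-trans (subst (p^ 2 ∣_) p^1+eG≡ (p^∣p^-+ 2 (suc (n ℕ.+ n)))) approx₁

  a∈𝒴 : ∀ n → In𝒴 p (a n)
  a∈𝒴 0 = ∈𝒴 a₀ 0 refl (<-by-slackₙ _ _ 0 (bound q′))
    where
    bound : ∀ q′ → suc (suc (suc q′) ℕ.+ suc (suc q′)) ℕ.* 1 ≡ suc (suc (suc q′) ℕ.* 2 ℕ.+ 0)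
    bound = ℕ-Solver.solve-∀
  a∈𝒴 1 = ∈𝒴 a₁ 1 p≡p^1 (<-by-slackₙ _ _ (4 ℕ.* q′ ℕ.* q′ ℕ.+ 20 ℕ.* q′ ℕ.+ 20) (bound q′))
    where
    bound : ∀ q′ → suc (suc (suc q′) ℕ.+ suc (suc q′)) ℕ.* suc (suc (suc q′) ℕ.+ suc (suc q′))
                   ≡ suc (2 ℕ.* 2 ℕ.+ (4 ℕ.* q′ ℕ.* q′ ℕ.+ 20 ℕ.* q′ ℕ.+ 20))
    bound = ℕ-Solver.solve-∀
  a∈𝒴 2 = ∈𝒴 a₂ eG dG≡ 1/G²-bound
  a∈𝒴 3 = ∈𝒴 a₃ 1 p≡p^1 (subst (λ z → z ℕ.* 2 < p ℕ.* suc (q ℕ.+ q)) (sym (∣1-n∣ (suc (q′ ℕ.+ q)))) 2q-1-bound)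
  a∈𝒴 4 = ∈𝒴 a₄ 1 p≡p^1 2q+3-bound
  a∈𝒴 5 = ∈𝒴 a₅ eG dG≡ 1/G²-bound
  a∈𝒴 6 = ∈𝒴 a₆ 1 p≡p^1 2q-1-bound
  a∈𝒴 7 = ∈𝒴 a₇ 1 p≡p^1 2q+3-bound
  a∈𝒴 (suc (suc (suc (suc (suc (suc (suc (suc k)))))))) = a∈𝒴 (suc (suc k))

  step : ∀ n → CFStep b (pᶠ n) (↥ (a n)) (CFState.Q (state n)) (CFState.Q (state (suc n)))
                                         (CFState.P (state n)) (CFState.P (state (suc n)))
  step 0 = step₀
  step 1 = step₁
  step 2 = step₂
  step 3 = step₃
  step 4 = step₄
  step 5 = step₅
  step 6 = step₆
  step 7 = step₇
  step (suc (suc (suc (suc (suc (suc (suc (suc k)))))))) = step (suc (suc k))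

  approx : ∀ n K → p^ (suc (CFState.e (state n))) ∣ root K - CFState.P (state (suc n))
  approx 0 K = near 1 K (+ q) (p^∣p^-+ 1 (suc eG)) (∣-respˡ-≡ (sym p^1≡) approx₀)
  approx 1 K = near 2 K P₂ (p^∣p^-+ 2 eG) p²∣T-P₂
  approx 2 K = near (suc eG) K P₃ (p^∣p^-suc (suc eG)) (∣-respˡ-≡ (sym p^1+eG≡) approx₂)
  approx 3 K = near 2 K P₄ (p^∣p^-+ 2 eG) (∣-respˡ-≡ (sym p^2≡) approx₃)
  approx 4 K = near 2 K P₂ (p^∣p^-+ 2 eG) p²∣T-P₂
  approx 5 K = near (suc eG) K P₃ (p^∣p^-suc (suc eG)) (∣-respˡ-≡ (sym p^1+eG≡) approx₂)
  approx 6 K = near 2 K P₄ (p^∣p^-+ 2 eG) (∣-respˡ-≡ (sym p^2≡) approx₃)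
  approx 7 K = near 2 K P₂ (p^∣p^-+ 2 eG) p²∣T-P₂
  approx (suc (suc (suc (suc (suc (suc (suc (suc k)))))))) = approx (suc (suc k))

  open Expansion b root root-sq root-cauchy

  expansion : ExpansionData
  expansion = record
    { state = state ; a = a ; f = f ; pᶠ = pᶠ ; state-zero = refl ; a-den = a-den ; pᶠ-spec = pᶠ-spec
    ; a∈𝒴 = a∈𝒴 ; step = step ; approx = approx }

  distinct : ∀ T′ → 0 < T′ → T′ < 6 → a (2 ℕ.+ T′) ≢ a 2
  distinct 1 _ _ a₃≡a₂ = ℕP.1+n≢0 (trans (sym (ℕP.+-suc q′ (suc q′))) (ℤP.-[1+-injective (cong ↥_ a₃≡a₂)))
  distinct 2 _ _ a₄≡a₂ with cong ↥_ a₄≡a₂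
  ... | ()
  distinct 3 _ _ a₅≡a₂ with cong ↥_ a₅≡a₂
  ... | ()
  distinct 4 _ _ a₆≡a₂ with cong ↥_ a₆≡a₂
  ... | ()
  distinct 5 _ _ a₇≡a₂ with cong ↥_ a₇≡a₂
  ... | ()
  distinct (suc (suc (suc (suc (suc (suc _)))))) _ (s≤s (s≤s (s≤s (s≤s (s≤s (s≤s ()))))))

  n<g : ∀ k → k < halfPower q k
  n<g zero    = s≤s z≤n
  n<g (suc k) = ℕP.<-≤-trans (s≤s (n<g k)) (≤-by-slackₙ _ _ (q ℕ.* (gₖ ℕ.+ gₖ) ℕ.+ suc q′) (grow q′ gₖ))
    where
    gₖ = halfPower q k
    grow : ∀ q′ g → suc (suc q′) ℕ.* (g ℕ.+ g) ℕ.+ suc (suc q′) ℕ.+ g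
                     ≡ suc g ℕ.+ (suc (suc q′) ℕ.* (g ℕ.+ g) ℕ.+ suc q′)
    grow = ℕ-Solver.solve-∀

  Lₙ : ℕ
  Lₙ = p ℕ.* g ℕ.+ q

  ∣b∣≡ : ∣ b ∣ ≡ Lₙ ℕ.* (Lₙ ℕ.+ 1)
  ∣b∣≡ = trans (cong ∣_∣ b≡) (ℤP.∣-i∣≡∣i∣ (+ (Lₙ ℕ.* (Lₙ ℕ.+ 1))))
    where
    L≡ : L ≡ + Lₙ
    L≡ = trans (cong (λ z → z * + g + + q) (sym (odd≡ q)))
               (trans (cong (_+ + q) (sym (ℤP.pos-* p g))) (sym (ℤP.pos-+ (p ℕ.* g) q)))
    b≡ : b ≡ - + (Lₙ ℕ.* (Lₙ ℕ.+ 1))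
    b≡ = cong -_ (trans (cong₂ _*_ L≡ (trans (cong (_+ + 1) L≡) (sym (ℤP.pos-+ Lₙ 1))))
                       (sym (ℤP.pos-* Lₙ (Lₙ ℕ.+ 1))))

  n≤∣b∣ : n ≤ ∣ b ∣
  n≤∣b∣ = subst (n ≤_) (sym ∣b∣≡)
    (ℕP.≤-trans (ℕP.<⇒≤ (n<g n)) (ℕP.≤-trans (≤-by-slackₙ g Lₙ ((q ℕ.+ q) ℕ.* g ℕ.+ q) (g≤L q g))
                                               (≤-by-slackₙ Lₙ _ (Lₙ ℕ.* Lₙ) (L≤L² Lₙ))))
    where
    g≤L : ∀ q g → suc (q ℕ.+ q) ℕ.* g ℕ.+ q ≡ g ℕ.+ ((q ℕ.+ q) ℕ.* g ℕ.+ q)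
    g≤L = ℕ-Solver.solve-∀
    L≤L² : ∀ L → L ℕ.* (L ℕ.+ 1) ≡ L ℕ.+ L ℕ.* L
    L≤L² = ℕ-Solver.solve-∀

  periodic-root : PeriodSixRoot p n
  periodic-root = b , n≤∣b∣ , √bₚ , √bₚ-isQp , √bₚ-square , a , isBrowkinCF expansion ,
                  periodLength a (λ k → a (2 ℕ.+ k)) 2 6 (λ _ → refl) (λ _ → refl) distinct

<-decide : ∀ {m n} → True (m ℕ.<? n) → m < n
<-decide = toWitness

record ThreeCycle : Set where
  field
    U D b c₀ V₁ P₂ V₂ P₃ P₄ V₄ P₅ V₅ P₆ V₆ P₇ N₃ : ℤ
    c₀-root : D ∣ c₀ * c₀ - b
    newton  : + 3 ∣ + 1 - (+ 2 * + 2) * c₀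
    unit₁   : + 3 ∣ + 1 - V₁ * - + 1
    unit₂   : + 3 ∣ + 1 - V₂ * + 1
    unit₄   : + 3 ∣ + 1 - V₄ * + 2
    unit₅   : + 3 ∣ + 1 - V₅ * - + 1
    unit₆   : + 3 ∣ + 1 - V₆ * + 2
    step₀   : CFStep b (+ 1) (+ 1) (+ 1 * + 1) (+ 3 * V₁) (+ 0) (+ 1)
    step₁   : CFStep b (+ 3) (+ 4) (+ 3 * V₁) (+ 9 * V₂) (+ 1) P₂
    step₂   : CFStep b (+ 9) (- + 4) (+ 9 * V₂) (U * - + 1) P₂ P₃
    step₃   : CFStep b U N₃ (U * - + 1) (+ 3 * V₄) P₃ P₄
    step₄   : CFStep b (+ 3) (- + 2) (+ 3 * V₄) (+ 3 * V₅) P₄ P₅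
    step₅   : CFStep b (+ 3) (+ 1) (+ 3 * V₅) (+ 3 * V₆) P₅ P₆
    step₆   : CFStep b (+ 3) (+ 4) (+ 3 * V₆) (+ 3 * V₁) P₆ P₇
    step₇   : CFStep b (+ 3) (+ 1) (+ 3 * V₁) (+ 9 * V₂) P₇ P₂
    approx₀ : + 3 ∣ c₀ - + 1
    approx₁ : + 9 ∣ c₀ - P₂
    approx₂ : + 27 ∣ c₀ - P₃
    approx₃ : P₄ ≡ c₀
    approx₄ : + 9 ∣ c₀ - P₅
    approx₅ : + 9 ∣ c₀ - P₆
    approx₆ : + 9 ∣ c₀ - P₇

-- U = 3^(4 + 5t) when 121 Y + 1 = 3^(5t)
threeCycle : ℤ → ThreeCycle
threeCycle Y =
  let U  = + 81 * (+ 121 * Y + + 1)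
      c₀ = - (+ 26730 * Y + + 221)
  in record
  { U = U ; D = + 3 * U ; b = - (+ 59049 * Y + + 488) ; c₀ = c₀
  ; V₁ = - (+ 19683 * Y + + 163) ; P₂ = - (+ 78732 * Y + + 653) ; V₂ = + 11664 * Y + + 97
  ; P₃ = + 32076 * Y + + 265 ; P₄ = c₀ ; V₄ = + 24300 * Y + + 203
  ; P₅ = - (+ 21870 * Y + + 185) ; V₅ = - (+ 2187 * Y + + 19)
  ; P₆ = + 19683 * Y + + 166 ; V₆ = + 19683 * Y + + 164
  ; P₇ = + 59049 * Y + + 490 ; N₃ = - (+ 5346 * Y + + 44)
  ; c₀-root = divides (+ 24300 * Y + + 203) (solve (Y ∷ []))
  ; newton  = divides (+ 35640 * Y + + 295) (solve (Y ∷ []))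
  ; unit₁   = divides (- (+ 6561 * Y + + 54)) (solve (Y ∷ []))
  ; unit₂   = divides (- (+ 3888 * Y + + 32)) (solve (Y ∷ []))
  ; unit₄   = divides (- (+ 16200 * Y + + 135)) (solve (Y ∷ []))
  ; unit₅   = divides (- (+ 729 * Y + + 6)) (solve (Y ∷ []))
  ; unit₆   = divides (- (+ 13122 * Y + + 109)) (solve (Y ∷ []))
  ; step₀   = solve (Y ∷ []) , solve (Y ∷ [])
  ; step₁   = solve (Y ∷ []) , solve (Y ∷ [])
  ; step₂   = solve (Y ∷ []) , solve (Y ∷ [])
  ; step₃   = solve (Y ∷ []) , solve (Y ∷ [])
  ; step₄   = solve (Y ∷ []) , solve (Y ∷ [])
  ; step₅   = solve (Y ∷ []) , solve (Y ∷ [])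
  ; step₆   = solve (Y ∷ []) , solve (Y ∷ [])
  ; step₇   = solve (Y ∷ []) , solve (Y ∷ [])
  ; approx₀ = divides (- (+ 8910 * Y + + 74)) (solve (Y ∷ []))
  ; approx₁ = divides (+ 5778 * Y + + 48) (solve (Y ∷ []))
  ; approx₂ = divides (- (+ 2178 * Y + + 18)) (solve (Y ∷ []))
  ; approx₃ = refl
  ; approx₄ = divides (- (+ 540 * Y + + 4)) (solve (Y ∷ []))
  ; approx₅ = divides (- (+ 5157 * Y + + 43)) (solve (Y ∷ []))
  ; approx₆ = divides (- (+ 9531 * Y + + 79)) (solve (Y ∷ []))
  }

-- (3^(5t) - 1)/121
powerQuotient : ℕ → ℕ
powerQuotient zero    = 0
powerQuotient (suc t) = 243 ℕ.* powerQuotient t ℕ.+ 2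

module ThreeFamily (t : ℕ) (3-prime : Prime 3) where

  open PAdic 3
  open Symmetric𝒴 3

  y eU dU : ℕ
  y  = powerQuotient t
  eU = 4 ℕ.+ 5 ℕ.* t
  dU = 9801 ℕ.* y ℕ.+ 80

  open ThreeCycle (threeCycle (+ y))

  3^5t≡ : ∀ t → 3 ℕ.^ (5 ℕ.* t) ≡ 121 ℕ.* powerQuotient t ℕ.+ 1
  3^5t≡ zero    = refl
  3^5t≡ (suc t) = trans (cong (3 ℕ.^_) (ℕP.*-suc 5 t))
    (trans (ℕP.^-distribˡ-+-* 3 5 (5 ℕ.* t)) (trans (cong (243 ℕ.*_) (3^5t≡ t)) (expand (powerQuotient t))))
    where
    expand : ∀ y → 243 ℕ.* (121 ℕ.* y ℕ.+ 1) ≡ 121 ℕ.* (243 ℕ.* y ℕ.+ 2) ℕ.+ 1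
    expand = ℕ-Solver.solve-∀

  dU≡ : suc dU ≡ 3 ℕ.^ eU
  dU≡ = sym (trans (ℕP.^-distribˡ-+-* 3 4 (5 ℕ.* t)) (trans (cong (81 ℕ.*_) (3^5t≡ t)) (expand y)))
    where
    expand : ∀ y → 81 ℕ.* (121 ℕ.* y ℕ.+ 1) ≡ suc (9801 ℕ.* y ℕ.+ 80)
    expand = ℕ-Solver.solve-∀

  U≡ : p^ eU ≡ U
  U≡ = trans (p^-+ 4 (5 ℕ.* t)) (cong (+ 81 *_) (trans (cong +_ (3^5t≡ t))
         (trans (ℤP.pos-+ (121 ℕ.* y) 1) (cong (_+ + 1) (ℤP.pos-* 121 y)))))

  D≡ : p^ (suc eU) ≡ D
  D≡ = trans (p^-suc eU) (cong (+ 3 *_) U≡)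

  open NewtonSqrt b c₀ (+ 2) D c₀-root (subst (+ 3 ∣_) D≡ (p∣p^-suc eU)) newton

  near : ∀ k K P′ → p^ k ∣ p^ (suc eU) → p^ k ∣ c₀ - P′ → p^ k ∣ root K - P′
  near k K P′ k∣D k∣c₀-P′ = ∣-via {x = root K} {y = c₀} (∣-trans (subst (p^ k ∣_) D≡ k∣D) (root-near-c₀ K)) k∣c₀-P′

  st₁ st₂ st₃ st₄ st₅ st₆ st₇ : CFState
  st₁ = unitState 1 (+ 3) refl (+ 1) V₁ (- + 1) unit₁
  st₂ = unitState 2 (+ 9) refl P₂ V₂ (+ 1) unit₂
  st₃ = unitState eU U U≡ P₃ (- + 1) (- + 1) (∣0 (+ 3))
  st₄ = unitState 1 (+ 3) refl P₄ V₄ (+ 2) unit₄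
  st₅ = unitState 1 (+ 3) refl P₅ V₅ (- + 1) unit₅
  st₆ = unitState 1 (+ 3) refl P₆ V₆ (+ 2) unit₆
  st₇ = unitState 1 (+ 3) refl P₇ V₁ (- + 1) unit₁

  3∤4 : ¬ (3 ℕD.∣ 4)
  3∤4 (ℕD.divides (suc (suc (suc (suc k)))) ())
  3∤4 (ℕD.divides (suc zero) ())
  3∤4 (ℕD.divides zero ())

  3∤2 : ¬ (3 ℕD.∣ 2)
  3∤2 = p∤ (s≤s z≤n) (s≤s (s≤s (s≤s z≤n)))

  ∣N₃∣≡ : ∣ N₃ ∣ ≡ 5346 ℕ.* y ℕ.+ 44
  ∣N₃∣≡ = trans (ℤP.∣-i∣≡∣i∣ (+ 5346 * + y + + 44))
    (cong ∣_∣ (trans (cong (_+ + 44) (sym (ℤP.pos-* 5346 y))) (sym (ℤP.pos-+ (5346 ℕ.* y) 44))))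

  3∤∣N₃∣ : ¬ (3 ℕD.∣ (5346 ℕ.* y ℕ.+ 44))
  3∤∣N₃∣ 3∣ = 3∤2 (ℕD.∣m+n∣m⇒∣n (subst (3 ℕD.∣_) (split y) 3∣) (ℕD.m∣m*n (1782 ℕ.* y ℕ.+ 14)))
    where
    split : ∀ y → 5346 ℕ.* y ℕ.+ 44 ≡ 3 ℕ.* (1782 ℕ.* y ℕ.+ 14) ℕ.+ 2
    split = ℕ-Solver.solve-∀

  a₀ a₁ a₂ a₃ a₄ a₅ : ℚ
  a₀ = mkℚ (+ 1) 0 (Coprime.1-coprimeTo 1)
  a₁ = mkℚ (+ 4) 2 (coprime-p 3-prime 3∤4)
  a₂ = mkℚ (- + 4) 8 (coprime-p^ 3-prime 3∤4 2)
  a₃ = mkℚ N₃ dU (subst₂ Coprime (sym ∣N₃∣≡) (sym dU≡) (coprime-p^ 3-prime 3∤∣N₃∣ eU))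
  a₄ = mkℚ (- + 2) 2 (coprime-p 3-prime 3∤2)
  a₅ = mkℚ (+ 1) 2 (Coprime.1-coprimeTo 3)

  state : ℕ → CFState
  state 0 = initialState
  state 1 = st₁
  state 2 = st₂
  state 3 = st₃
  state 4 = st₄
  state 5 = st₅
  state 6 = st₆
  state 7 = st₇
  state (suc (suc (suc (suc (suc (suc (suc (suc k)))))))) = state (suc (suc k))

  a : ℕ → ℚ
  a 0 = a₀
  a 1 = a₁
  a 2 = a₂
  a 3 = a₃
  a 4 = a₄
  a 5 = a₅
  a 6 = a₁
  a 7 = a₅
  a (suc (suc (suc (suc (suc (suc (suc (suc k)))))))) = a (suc (suc k))

  f : ℕ → ℕ
  f 0 = 0
  f 1 = 1
  f 2 = 2
  f 3 = eU
  f 4 = 1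
  f 5 = 1
  f 6 = 1
  f 7 = 1
  f (suc (suc (suc (suc (suc (suc (suc (suc k)))))))) = f (suc (suc k))

  pᶠ : ℕ → ℤ
  pᶠ 0 = + 1
  pᶠ 1 = + 3
  pᶠ 2 = + 9
  pᶠ 3 = U
  pᶠ 4 = + 3
  pᶠ 5 = + 3
  pᶠ 6 = + 3
  pᶠ 7 = + 3
  pᶠ (suc (suc (suc (suc (suc (suc (suc (suc k)))))))) = pᶠ (suc (suc k))

  a-den : ∀ n → ↧ₙ (a n) ≡ 3 ℕ.^ f n
  a-den 0 = refl
  a-den 1 = refl
  a-den 2 = refl
  a-den 3 = dU≡
  a-den 4 = refl
  a-den 5 = refl
  a-den 6 = refl
  a-den 7 = refl
  a-den (suc (suc (suc (suc (suc (suc (suc (suc k)))))))) = a-den (suc (suc k))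

  pᶠ-spec : ∀ n → p^ (f n) ≡ pᶠ n
  pᶠ-spec 0 = refl
  pᶠ-spec 1 = refl
  pᶠ-spec 2 = refl
  pᶠ-spec 3 = U≡
  pᶠ-spec 4 = refl
  pᶠ-spec 5 = refl
  pᶠ-spec 6 = refl
  pᶠ-spec 7 = refl
  pᶠ-spec (suc (suc (suc (suc (suc (suc (suc (suc k)))))))) = pᶠ-spec (suc (suc k))

  N₃-bound : (5346 ℕ.* y ℕ.+ 44) ℕ.* 2 < 3 ℕ.* suc dU
  N₃-bound = <-by-slackₙ _ _ (18711 ℕ.* y ℕ.+ 154) (bound y)
    where
    bound : ∀ y → 3 ℕ.* suc (9801 ℕ.* y ℕ.+ 80) ≡ suc ((5346 ℕ.* y ℕ.+ 44) ℕ.* 2 ℕ.+ (18711 ℕ.* y ℕ.+ 154))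
    bound = ℕ-Solver.solve-∀

  a∈𝒴 : ∀ n → In𝒴 3 (a n)
  a∈𝒴 0 = ∈𝒴 a₀ 0 refl (<-decide _)
  a∈𝒴 1 = ∈𝒴 a₁ 1 refl (<-decide _)
  a∈𝒴 2 = ∈𝒴 a₂ 2 refl (<-decide _)
  a∈𝒴 3 = ∈𝒴 a₃ eU dU≡ (subst (λ z → z ℕ.* 2 < 3 ℕ.* suc dU) (sym ∣N₃∣≡) N₃-bound)
  a∈𝒴 4 = ∈𝒴 a₄ 1 refl (<-decide _)
  a∈𝒴 5 = ∈𝒴 a₅ 1 refl (<-decide _)
  a∈𝒴 6 = ∈𝒴 a₁ 1 refl (<-decide _)
  a∈𝒴 7 = ∈𝒴 a₅ 1 refl (<-decide _)
  a∈𝒴 (suc (suc (suc (suc (suc (suc (suc (suc k)))))))) = a∈𝒴 (suc (suc k))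

  step : ∀ n → CFStep b (pᶠ n) (↥ (a n)) (CFState.Q (state n)) (CFState.Q (state (suc n)))
                                         (CFState.P (state n)) (CFState.P (state (suc n)))
  step 0 = step₀
  step 1 = step₁
  step 2 = step₂
  step 3 = step₃
  step 4 = step₄
  step 5 = step₅
  step 6 = step₆
  step 7 = step₇
  step (suc (suc (suc (suc (suc (suc (suc (suc k)))))))) = step (suc (suc k))

  approx : ∀ n K → p^ (suc (CFState.e (state n))) ∣ root K - CFState.P (state (suc n))
  approx 0 K = near 1 K (+ 1) (p^∣p^-+ 1 eU) approx₀
  approx 1 K = near 2 K P₂ (p^∣p^-+ 2 (3 ℕ.+ 5 ℕ.* t)) approx₁
  approx 2 K = near 3 K P₃ (p^∣p^-+ 3 (2 ℕ.+ 5 ℕ.* t)) approx₂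
  approx 3 K = near (suc eU) K P₄ ∣-refl (subst (λ z → p^ (suc eU) ∣ c₀ - z) (sym approx₃) (≡⇒∣- {x = c₀} refl))
  approx 4 K = near 2 K P₅ (p^∣p^-+ 2 (3 ℕ.+ 5 ℕ.* t)) approx₄
  approx 5 K = near 2 K P₆ (p^∣p^-+ 2 (3 ℕ.+ 5 ℕ.* t)) approx₅
  approx 6 K = near 2 K P₇ (p^∣p^-+ 2 (3 ℕ.+ 5 ℕ.* t)) approx₆
  approx 7 K = near 2 K P₂ (p^∣p^-+ 2 (3 ℕ.+ 5 ℕ.* t)) approx₁
  approx (suc (suc (suc (suc (suc (suc (suc (suc k)))))))) = approx (suc (suc k))

  open Expansion b root root-sq root-cauchy

  expansion : ExpansionData
  expansion = record
    { state = state ; a = a ; f = f ; pᶠ = pᶠ ; state-zero = refl ; a-den = a-den ; pᶠ-spec = pᶠ-spec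
    ; a∈𝒴 = a∈𝒴 ; step = step ; approx = approx }

  distinct : ∀ T′ → 0 < T′ → T′ < 6 → a (2 ℕ.+ T′) ≢ a 2
  distinct 1 _ _ a₃≡a₂ = ℕP.<-irrefl (sym (ℕP.suc-injective (cong ↧ₙ_ a₃≡a₂))) 8<dU
    where
    8<dU : 8 < dU
    8<dU = <-by-slackₙ 8 dU (9801 ℕ.* y ℕ.+ 71) (split y)
      where
      split : ∀ y → 9801 ℕ.* y ℕ.+ 80 ≡ suc (8 ℕ.+ (9801 ℕ.* y ℕ.+ 71))
      split = ℕ-Solver.solve-∀
  distinct 2 _ _ a₄≡a₂ with cong ↥_ a₄≡a₂
  ... | ()
  distinct 3 _ _ a₅≡a₂ with cong ↥_ a₅≡a₂
  ... | ()
  distinct 4 _ _ a₁≡a₂ with cong ↥_ a₁≡a₂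
  ... | ()
  distinct 5 _ _ a₅≡a₂ with cong ↥_ a₅≡a₂
  ... | ()
  distinct (suc (suc (suc (suc (suc (suc _)))))) _ (s≤s (s≤s (s≤s (s≤s (s≤s (s≤s ()))))))

  t≤y : ∀ k → k ≤ powerQuotient k
  t≤y zero    = z≤n
  t≤y (suc k) = ℕP.≤-trans (s≤s (t≤y k)) (≤-by-slackₙ _ _ (242 ℕ.* powerQuotient k ℕ.+ 1) (grow (powerQuotient k)))
    where
    grow : ∀ y → 243 ℕ.* y ℕ.+ 2 ≡ suc y ℕ.+ (242 ℕ.* y ℕ.+ 1)
    grow = ℕ-Solver.solve-∀

  t≤∣b∣ : t ≤ ∣ b ∣
  t≤∣b∣ = subst (t ≤_) (sym ∣b∣≡) (ℕP.≤-trans (t≤y t) (≤-by-slackₙ y _ (59048 ℕ.* y ℕ.+ 488) (grow y)))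
    where
    ∣b∣≡ : ∣ b ∣ ≡ 59049 ℕ.* y ℕ.+ 488
    ∣b∣≡ = trans (ℤP.∣-i∣≡∣i∣ (+ 59049 * + y + + 488))
      (cong ∣_∣ (trans (cong (_+ + 488) (sym (ℤP.pos-* 59049 y))) (sym (ℤP.pos-+ (59049 ℕ.* y) 488))))
    grow : ∀ y → 59049 ℕ.* y ℕ.+ 488 ≡ y ℕ.+ (59048 ℕ.* y ℕ.+ 488)
    grow = ℕ-Solver.solve-∀

  periodic-root : PeriodSixRoot 3 t
  periodic-root = b , t≤∣b∣ , √bₚ , √bₚ-isQp , √bₚ-square , a , isBrowkinCF expansion ,
                  periodLength a (λ k → a (2 ℕ.+ k)) 2 6 (λ _ → refl) (λ _ → refl) distinct

parity : ∀ n → (∃ λ k → n ≡ k ℕ.+ k) ⊎ (∃ λ k → n ≡ suc (k ℕ.+ k))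
parity zero = inj₁ (0 , refl)
parity (suc n) with parity n
... | inj₁ (k , refl) = inj₂ (k , refl)
... | inj₂ (k , refl) = inj₁ (suc k , cong suc (sym (ℕP.+-suc k k)))

odd-prime : ∀ {p} → Prime p → 2 < p → ∃ λ q → p ≡ suc (q ℕ.+ q)
odd-prime {p} p-prime 2<p with parity p
... | inj₂ odd = odd
... | inj₁ (k , refl)
  with prime⇒irreducible p-prime (ℕD.divides k (trans (cong (k ℕ.+_) (sym (ℕP.+-identityʳ k))) (ℕP.*-comm 2 k)))
...   | inj₁ ()
...   | inj₂ 2≡p = ⊥-elim (ℕP.<-irrefl 2≡p 2<p)

proposition5p14 : (p : ℕ) → Prime p → 2 < p →
    Nice p (((+ 1) /ℕ p) ∷ ((+ 1 + - (+ p)) /ℕ p) ∷ ((+ 1 + + p) /ℕ p) ∷ [])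
    × (∀ (N : ℕ) → Σ ℤ λ b → N ≤ ∣ b ∣ × Σ ℚₚ λ γ → IsQp p γ ×
         (mulₚ γ γ ≈[ p ] ιₚ b) ×
         Σ (ℕ → ℚ) λ a → IsBrowkinCF p γ a × PeriodLength a 6)
proposition5p14 p p-prime 2<p with odd-prime p-prime 2<p
... | zero , refl = ⊥-elim (ℕP.<-asym 2<p (s≤s (s≤s z≤n)))
... | suc zero , refl = Niceness.nice 0 , λ N → ThreeFamily.periodic-root N p-prime
... | suc (suc q′) , refl = Niceness.nice (suc q′) , λ N → LargePrimeFamily.periodic-root q′ N p-prime
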